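{- If a $(d-1)$-dimensional simplicial complex $\Delta$ has a PS-ear decomposition, then its complementary $h$-vector $\bar h(\Delta)$ is a sum of $h_d-1$ M-vectors.
   Context: $h$-vector: $h_i=\sum_{j=0}^i(-1)^{i-j}\binom{d-j}{d-i}f_j$, where $f_j$ is the number of faces with $j$ vertices. The complementary $h$-vector is $\bar h=(h_d-h_0,h_{d-1}-h_1,\dots,h_{d-\lfloor d/2\rfloor}-h_{d-\lceil d/2\rceil})$. A convex ear decomposition of $\Delta$ is an ordered sequence $\Delta_1,\dots,\Delta_m$ of pure $(d-1)$-dimensional subcomplexes such that: (1) $\Delta_1$ is the boundary complex of a simplicial $d$-polytope, and for $j\ge2$, $\Delta_j$ is a $(d-1)$-ball that is a proper subcomplex of the boundary complex of a simplicial $d$-polytope; (2) for $j\ge2$, $\Delta_j\cap\bigcup_{i<j}\Delta_i=\partial\Delta_j$; (3) $\bigcup_j\Delta_j=\Delta$. A PS-ear decomposition is a convex ear decomposition in which $\Delta_1$ is a join of boundaries of simplices and each $\Delta_j$, $j\ge2$, is a join of a simplex and boundaries of simplices. An M-vector is the Hilbert function of a homogeneous quotient of a polynomial ring. -}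

module Defs where

open import Data.Bool.Base using (Bool; true; false; _∧_; _∨_; not; if_then_else_)
open import Data.Nat.Base as ℕ using (ℕ; zero; suc; _∸_; _≡ᵇ_; _≤ᵇ_)
open import Data.Nat.Combinatorics using (_C_)
open import Data.Integer.Base as ℤ using (ℤ; +_; -1ℤ)
open import Data.Fin.Base using (Fin; zero; suc; toℕ)
open import Data.Fin.Subset using (Subset; inside; outside; ∣_∣; _⊆_)
open import Data.Vec.Base as Vec using (Vec; []; _∷_; lookup; replicate)
open import Data.Vec.Relation.Binary.Pointwise.Inductive using (Pointwise)
open import Data.List.Base as List using (List; []; _∷_; _++_; map; length; filterᵇ; allFin; foldr)
open import Data.Bool.ListAction using (all; any)
open import Data.List.Membership.Propositional using (_∈_)
open import Data.List.Relation.Unary.Unique.Propositional using (Unique)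
open import Data.Product using (Σ; ∃; ∃-syntax; _×_)
open import Relation.Binary.PropositionalEquality using (_≡_; _≢_)
open import Relation.Nullary.Decidable using (⌊_⌋)
open import Function.Bundles using (_⇔_)
import Data.Fin.Properties as FinP

Complex : ℕ → Set
Complex n = Subset n → Bool

_∋_ : ∀ {n} → Complex n → Subset n → Set
Δ ∋ F = Δ F ≡ true

IsSimplicialComplex : ∀ {n} → Complex n → Set
IsSimplicialComplex {n} Δ =
  (Δ ∋ Data.Fin.Subset.⊥) × (∀ (F G : Subset n) → G ⊆ F → Δ ∋ F → Δ ∋ G)

-- Δ is (d-1)-dimensional: every face has at most d vertices and some face has d vertices.
HasDim : ∀ {n} → ℕ → Complex n → Set
HasDim {n} d Δ = (∀ F → Δ ∋ F → ∣ F ∣ ℕ.≤ d) × (∃[ G ] (Δ ∋ G × ∣ G ∣ ≡ d))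

IsPureDim : ∀ {n} → ℕ → Complex n → Set
IsPureDim {n} d Δ =
  ∀ F → Δ ∋ F → (∣ F ∣ ℕ.≤ d) × (∃[ G ] (Δ ∋ G × ∣ G ∣ ≡ d × F ⊆ G))

allSubsets : (n : ℕ) → List (Subset n)
allSubsets zero = [] ∷ []
allSubsets (suc n) = map (inside ∷_) (allSubsets n) ++ map (outside ∷_) (allSubsets n)

countᵇ : ∀ {A : Set} → (A → Bool) → List A → ℕ
countᵇ p xs = length (filterᵇ p xs)

_⊆ᵇ_ : ∀ {n} → Subset n → Subset n → Bool
[] ⊆ᵇ [] = true
(a ∷ F) ⊆ᵇ (b ∷ G) = (not a ∨ b) ∧ (F ⊆ᵇ G)

_∈ᵇ_ : ∀ {n} → Fin n → Subset n → Bool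
x ∈ᵇ F = lookup F x

fvec : ∀ {n} → Complex n → ℕ → ℕ
fvec {n} Δ j = countᵇ (λ F → Δ F ∧ (∣ F ∣ ≡ᵇ j)) (allSubsets n)

sumTo : ℕ → (ℕ → ℤ) → ℤ
sumTo zero g = g zero
sumTo (suc i) g = sumTo i g ℤ.+ g (suc i)

hvec : ∀ {n} → ℕ → Complex n → ℕ → ℤ
hvec d Δ i = sumTo i (λ j → (-1ℤ ℤ.^ (i ∸ j)) ℤ.* ((+ ((d ∸ j) C (d ∸ i))) ℤ.* (+ fvec Δ j)))

hbar : ∀ {n} → ℕ → Complex n → ℕ → ℤ
hbar d Δ i = hvec d Δ (d ∸ i) ℤ.- hvec d Δ i

facetsContaining : ∀ {n} → ℕ → Complex n → Subset n → ℕ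
facetsContaining {n} d Δ G = countᵇ (λ H → Δ H ∧ (∣ H ∣ ≡ᵇ d) ∧ (G ⊆ᵇ H)) (allSubsets n)

Boundary : ∀ {n} → ℕ → Complex n → Subset n → Set
Boundary d Δ F =
  ∃[ G ] (Δ ∋ G × ∣ G ∣ ≡ d ∸ 1 × F ⊆ G × facetsContaining d Δ G ≡ 1)

-- Joins  σ * ∂σ₁ * ... * ∂σₖ  of a simplex σ and boundaries of simplices σᵢ,
-- all on pairwise disjoint vertex sets inside Fin n.  A vertex labelled
-- `apex` belongs to σ, a vertex labelled `block i` belongs to σᵢ, and an
-- `unused` vertex belongs to none of them.

data Label (k : ℕ) : Set where
  unused : Label k
  apex   : Label k
  block  : Fin k → Label k

isUnused : ∀ {k} → Label k → Bool
isUnused unused = true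
isUnused apex = false
isUnused (block _) = false

isBlock : ∀ {k} → Fin k → Label k → Bool
isBlock i unused = false
isBlock i apex = false
isBlock i (block j) = ⌊ i FinP.≟ j ⌋

record PSJoin (n : ℕ) : Set where
  field
    k   : ℕ
    lab : Fin n → Label k

open PSJoin public

joinComplex : ∀ {n} → PSJoin n → Complex n
joinComplex {n} J F =
  all (λ x → not (x ∈ᵇ F) ∨ not (isUnused (lab J x))) (allFin n)
  ∧ all (λ i → any (λ x → isBlock i (lab J x) ∧ not (x ∈ᵇ F)) (allFin n)) (allFin (k J))

BlocksNonempty : ∀ {n} → PSJoin n → Set
BlocksNonempty J = ∀ i → ∃[ x ] (lab J x ≡ block i)

NoApex : ∀ {n} → PSJoin n → Set
NoApex J = ∀ x → lab J x ≢ apex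

HasApex : ∀ {n} → PSJoin n → Set
HasApex J = ∃[ x ] (lab J x ≡ apex)

-- PS-ear decomposition Δ₁, ..., Δ_{m+1} of a (d-1)-dimensional complex Δ.
-- Ears are indexed by Fin (suc m); index zero is Δ₁.

record PSEarDecomposition {n : ℕ} (d : ℕ) (Δ : Complex n) : Set where
  field
    m              : ℕ
    ears           : Fin (suc m) → PSJoin n
    blocksNonempty : ∀ j → BlocksNonempty (ears j)
    pure           : ∀ j → IsPureDim d (joinComplex (ears j))
    firstSphere    : NoApex (ears zero)
    laterBalls     : ∀ (j : Fin m) → HasApex (ears (suc j))
    glue           : ∀ (j : Fin m) (F : Subset n) →
                     ((joinComplex (ears (suc j)) ∋ F)
                       × (∃[ i ] (toℕ i ℕ.< toℕ (suc j) × joinComplex (ears i) ∋ F)))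
                     ⇔ Boundary d (joinComplex (ears (suc j))) F
    cover          : ∀ (F : Subset n) → (Δ ∋ F) ⇔ (∃[ j ] (joinComplex (ears j) ∋ F))

-- M-vectors.  (m₀, ..., m_L) is an M-vector if it is the Hilbert function
-- (in degrees 0..L) of S/I for a polynomial ring S = k[x₁..x_r] and a proper
-- monomial ideal I; the standard monomials of S/I (those not in I) form a
-- nonempty order ideal of monomials, and only degrees ≤ L matter, so we
-- represent them by a finite, duplicate-free, divisor-closed list of exponent
-- vectors containing 1.

degree : ∀ {r} → Vec ℕ r → ℕ
degree = Vec.sum

IsMVector : ℕ → (ℕ → ℕ) → Set
IsMVector L M =
  ∃[ r ] ∃[ O ]
    ( Unique {A = Vec ℕ r} O
    × (replicate r 0 ∈ O)
    × (∀ u v → u ∈ O → Pointwise ℕ._≤_ v u → v ∈ O)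
    × (∀ i → i ℕ.≤ L → M i ≡ countᵇ (λ u → degree u ≡ᵇ i) O))

sumℤ : List ℤ → ℤ
sumℤ = foldr ℤ._+_ (+ 0)

-- Each face of Δ is new in exactly one ear, so h(Δ) is the sum over the ears of the h-contributions
-- of their new faces.  Write [c] = 1 + t + ⋯ + t^(c-1) for the h-polynomial of the boundary of a
-- simplex with c vertices.  The first ear ∂σ₁ * ⋯ * ∂σₖ contributes ∏ [∣σᵢ∣]; the new faces of a
-- later ear σ * ∂σ₁ * ⋯ * ∂σₖ are exactly those containing σ, and contribute t^∣σ∣ ∏ [∣σᵢ∣].  These
-- products are palindromic of degree d - ∣σ∣, so in h_{d-i} - h_i the first ear cancels and a later
-- ear contributes the coefficient of t^i in (1 - t^∣σ∣) ∏ [∣σᵢ∣] = (1 - t) [∣σ∣] ∏ [∣σᵢ∣].  For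
-- 2i ≤ d this first difference of a product of chains is the Hilbert function of an explicit order
-- ideal of monomials, hence an M-vector.  Finally h_d = 1 + (number of later ears).

module Submission where

open import Defs
open import Data.Nat.Base using (ℕ; _≤_; ⌊_/2⌋)
open import Data.Integer.Base using (ℤ; +_; _-_; 1ℤ)
open import Data.List.Base using (List; length; map)
open import Data.List.Relation.Unary.All using (All)
open import Data.Product using (∃-syntax; _×_)
open import Relation.Binary.PropositionalEquality using (_≡_)

open import Data.Bool using (Bool; true; false; _∧_; _∨_; not; if_then_else_)
import Data.Bool.Properties as BP
open import Data.Bool.ListAction using (all; any)
open import Data.Empty using (⊥; ⊥-elim)
open import Data.Fin using (Fin; zero; suc; toℕ)
import Data.Fin.Properties as FinP
open import Data.Fin.Subset using (Subset; inside; outside; ∣_∣; _⊆_)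
open import Data.Integer using (-[1+_]; _+_; _*_; -_; 0ℤ; -1ℤ; _^_)
import Data.Integer.Properties as ℤP
open import Data.Integer.Tactic.RingSolver using (solve-∀)
open import Data.List as List using ([]; _∷_; _++_; filterᵇ; cartesianProductWith; applyUpTo; upTo; allFin)
import Data.List.Properties as LP
open import Data.List.Membership.Propositional using (_∈_)
import Data.List.Membership.Propositional.Properties as ∈P
import Data.List.Relation.Unary.All as AllList
import Data.List.Relation.Unary.All.Properties as AllP
import Data.List.Relation.Unary.AllPairs as AllPairs
import Data.List.Relation.Unary.Any as Any
open import Data.List.Relation.Unary.Unique.Propositional using (Unique)
import Data.List.Relation.Unary.Unique.Propositional.Properties as UniqueP
open import Data.Nat as ℕ using (zero; suc; _<_; z≤n; s≤s; _≡ᵇ_)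
open import Data.Nat.Combinatorics using (_C_; nCk+nC[k+1]≡[n+1]C[k+1]; nCk≡nC[n∸k])
import Data.Nat.Properties as ℕP
import Data.Nat.Tactic.RingSolver as NatSolver
open import Data.Product using (_,_; proj₁; proj₂)
open import Data.Sum using (_⊎_; inj₁; inj₂)
open import Data.Vec as Vec using (Vec; []; _∷_; lookup; _[_]≔_)
import Data.Vec.Properties as VP
open import Data.Vec.Relation.Binary.Pointwise.Inductive using (Pointwise; []; _∷_)
open import Data.Vec.Relation.Unary.All using ([]; _∷_) renaming (All to AllVec)
import Data.Vec.Relation.Unary.All.Properties as AllVecP
open import Function using (_∘_)
open import Function.Bundles using (_⇔_; Equivalence; mk⇔)
open import Relation.Binary.Definitions using (tri<; tri≈; tri>)
open import Relation.Binary.PropositionalEquality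
open import Relation.Nullary using (yes; no; contradiction)
open import Relation.Nullary.Decidable.Core using (T?)

open import Algebra.Properties.CommutativeMonoid.Sum ℤP.+-0-commutativeMonoid
  using (sum; sum-syntax; sum-cong-≗; ∑-distrib-+; sum-replicate-zero)
open import Algebra.Properties.CommutativeMonoid.Sum ℕP.+-0-commutativeMonoid
  using () renaming (sum to sumℕ; sum-cong-≗ to sumℕ-cong-≗; sum-replicate-zero to sumℕ-zero)
open import Algebra.Properties.CommutativeSemigroup ℤP.+-commutativeSemigroup using (interchange)

sumBy : ∀ {A : Set} → (A → ℤ) → List A → ℤ
sumBy f [] = 0ℤ
sumBy f (x ∷ xs) = f x + sumBy f xs

sumBy-++ : ∀ {A : Set} (f : A → ℤ) xs ys → sumBy f (xs ++ ys) ≡ sumBy f xs + sumBy f ys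
sumBy-++ f [] ys = sym (ℤP.+-identityˡ _)
sumBy-++ f (x ∷ xs) ys rewrite sumBy-++ f xs ys = sym (ℤP.+-assoc (f x) _ _)

sumBy-map : ∀ {A B : Set} (f : B → ℤ) (g : A → B) xs → sumBy f (map g xs) ≡ sumBy (f ∘ g) xs
sumBy-map f g [] = refl
sumBy-map f g (x ∷ xs) = cong (_+_ (f (g x))) (sumBy-map f g xs)

sumBy-cong : ∀ {A : Set} {f g : A → ℤ} → (∀ x → f x ≡ g x) → ∀ xs → sumBy f xs ≡ sumBy g xs
sumBy-cong e [] = refl
sumBy-cong e (x ∷ xs) = cong₂ _+_ (e x) (sumBy-cong e xs)

sumBy-zero : ∀ {A : Set} {f : A → ℤ} → (∀ x → f x ≡ 0ℤ) → ∀ xs → sumBy f xs ≡ 0ℤ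
sumBy-zero e [] = refl
sumBy-zero e (x ∷ xs) rewrite e x = trans (ℤP.+-identityˡ _) (sumBy-zero e xs)

sumBy-+ : ∀ {A : Set} (f g : A → ℤ) xs → sumBy (λ x → f x + g x) xs ≡ sumBy f xs + sumBy g xs
sumBy-+ f g [] = refl
sumBy-+ f g (x ∷ xs) rewrite sumBy-+ f g xs = interchange (f x) (g x) _ _

sumBy-neg : ∀ {A : Set} (f : A → ℤ) xs → sumBy (λ x → - f x) xs ≡ - sumBy f xs
sumBy-neg f [] = refl
sumBy-neg f (x ∷ xs) rewrite sumBy-neg f xs = sym (ℤP.neg-distrib-+ (f x) _)

sumBy-sum : ∀ {A : Set} m (g : Fin m → A → ℤ) xs →
  sumBy (λ x → ∑[ e < m ] g e x) xs ≡ ∑[ e < m ] sumBy (g e) xs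
sumBy-sum m g [] = sym (sum-replicate-zero m)
sumBy-sum m g (x ∷ xs) rewrite sumBy-sum m g xs = sym (∑-distrib-+ (λ e → g e x) (λ e → sumBy (g e) xs))

sum-neg : ∀ m (f : Fin m → ℤ) → ∑[ j < m ] (- f j) ≡ - sum f
sum-neg zero f = refl
sum-neg (suc m) f rewrite sum-neg m (f ∘ suc) = sym (ℤP.neg-distrib-+ (f zero) _)

sum-difference : ∀ m (f g : Fin m → ℤ) → ∑[ j < m ] (f j - g j) ≡ sum f - sum g
sum-difference m f g = trans (∑-distrib-+ f (λ j → - g j)) (cong (_+_ (sum f)) (sum-neg m g))

sum-ones : ∀ m → ∑[ j < m ] 1ℤ ≡ + m
sum-ones zero = refl
sum-ones (suc m) rewrite sum-ones m = refl

telescope : ∀ c (g : ℕ → ℤ) → ∑[ t < c ] (g (toℕ t) - g (suc (toℕ t))) ≡ g 0 - g c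
telescope zero g = sym (ℤP.+-inverseʳ (g 0))
telescope (suc c) g = trans (cong (_+_ (g 0 - g 1)) (telescope c (g ∘ suc))) (cancel (g 0) (g 1) (g (suc c)))
  where
  cancel : ∀ a b c → a - b + (b - c) ≡ a - c
  cancel = solve-∀

-- Polynomials in one variable t with integer coefficients

-- A polynomial is its coefficient sequence, indexed by ℤ so that multiplication by a power of t is
-- a shift of the index.
Poly : Set
Poly = ℤ → ℤ

1ₚ : Poly
1ₚ (+ zero) = 1ℤ
1ₚ (+ suc _) = 0ℤ
1ₚ -[1+ _ ] = 0ℤ

mulChain : ℕ → Poly → Poly
mulChain zero f i = 0ℤ
mulChain (suc c) f i = f i + mulChain c f (i - 1ℤ)

chainProduct : ∀ {r} → Vec ℕ r → Poly
chainProduct [] = 1ₚ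
chainProduct (c ∷ cs) = mulChain c (chainProduct cs)

chainDegree : ∀ {r} → Vec ℕ r → ℕ
chainDegree [] = 0
chainDegree (c ∷ cs) = (c ℕ.∸ 1) ℕ.+ chainDegree cs

mulChain-cong : ∀ c {f g : Poly} → (∀ i → f i ≡ g i) → ∀ i → mulChain c f i ≡ mulChain c g i
mulChain-cong zero e i = refl
mulChain-cong (suc c) e i = cong₂ _+_ (e i) (mulChain-cong c e (i - 1ℤ))

mulChain-+ : ∀ c (f g : Poly) i → mulChain c (λ j → f j + g j) i ≡ mulChain c f i + mulChain c g i
mulChain-+ zero f g i = refl
mulChain-+ (suc c) f g i rewrite mulChain-+ c f g (i - 1ℤ) = interchange (f i) (g i) _ _

mulChain-shift : ∀ c (f : Poly) i → mulChain c (λ j → f (j - 1ℤ)) i ≡ mulChain c f (i - 1ℤ)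
mulChain-shift zero f i = refl
mulChain-shift (suc c) f i = cong (_+_ (f (i - 1ℤ))) (mulChain-shift c f (i - 1ℤ))

mulChain-zero : ∀ c {f : Poly} → (∀ i → f i ≡ 0ℤ) → ∀ i → mulChain c f i ≡ 0ℤ
mulChain-zero zero e i = refl
mulChain-zero (suc c) e i rewrite e i | mulChain-zero c e (i - 1ℤ) = refl

mulChain-1 : ∀ (f : Poly) i → mulChain 1 f i ≡ f i
mulChain-1 f i = ℤP.+-identityʳ (f i)

mulChain-suc : ∀ c (f : Poly) i → mulChain (suc c) f i ≡ mulChain c f i + f (i - + c)
mulChain-suc zero f i = trans (ℤP.+-identityʳ (f i)) (trans (cong f (sym (ℤP.+-identityʳ i))) (sym (ℤP.+-identityˡ _)))
mulChain-suc (suc c) f i =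
  begin
    f i + mulChain (suc c) f (i - 1ℤ)
  ≡⟨ cong (_+_ (f i)) (mulChain-suc c f (i - 1ℤ)) ⟩
    f i + (mulChain c f (i - 1ℤ) + f (i - 1ℤ - + c))
  ≡⟨ sym (ℤP.+-assoc (f i) _ _) ⟩
    f i + mulChain c f (i - 1ℤ) + f (i - 1ℤ - + c)
  ≡⟨ cong (λ j → f i + mulChain c f (i - 1ℤ) + f j) (i-1-x≡i-[1+x] i (+ c)) ⟩
    f i + mulChain c f (i - 1ℤ) + f (i - + suc c)
  ∎
  where
  open ≡-Reasoning
  i-1-x≡i-[1+x] : ∀ i x → i - 1ℤ - x ≡ i - (1ℤ + x)
  i-1-x≡i-[1+x] = solve-∀

mulChain-difference : ∀ c (f : Poly) i → mulChain c f i - mulChain c f (i - 1ℤ) ≡ f i - f (i - + c)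
mulChain-difference zero f i = trans (sym (ℤP.+-inverseʳ (f i))) (cong (λ j → f i - f j) (sym (ℤP.+-identityʳ i)))
mulChain-difference (suc c) f i =
  begin
    (f i + mulChain c f (i - 1ℤ)) - (f (i - 1ℤ) + mulChain c f (i - 1ℤ - 1ℤ))
  ≡⟨ regroup (f i) (f (i - 1ℤ)) _ _ ⟩
    f i - f (i - 1ℤ) + (mulChain c f (i - 1ℤ) - mulChain c f (i - 1ℤ - 1ℤ))
  ≡⟨ cong (_+_ (f i - f (i - 1ℤ))) (mulChain-difference c f (i - 1ℤ)) ⟩
    f i - f (i - 1ℤ) + (f (i - 1ℤ) - f (i - 1ℤ - + c))
  ≡⟨ cancel (f i) (f (i - 1ℤ)) _ ⟩
    f i - f (i - 1ℤ - + c)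
  ≡⟨ cong (λ j → f i - f j) (i-1-x≡i-[1+x] i (+ c)) ⟩
    f i - f (i - + suc c)
  ∎
  where
  open ≡-Reasoning
  regroup : ∀ a b x y → (a + x) - (b + y) ≡ a - b + (x - y)
  regroup = solve-∀
  cancel : ∀ a b c → a - b + (b - c) ≡ a - c
  cancel = solve-∀
  i-1-x≡i-[1+x] : ∀ i x → i - 1ℤ - x ≡ i - (1ℤ + x)
  i-1-x≡i-[1+x] = solve-∀

SupportedOnℕ : Poly → Set
SupportedOnℕ f = ∀ n → f -[1+ n ] ≡ 0ℤ

mulChain-supported : ∀ c {f : Poly} → SupportedOnℕ f → SupportedOnℕ (mulChain c f)
mulChain-supported zero s n = refl
mulChain-supported (suc c) {f} s n =
  cong₂ _+_ (s n) (trans (cong (λ k → mulChain c f -[1+ suc k ]) (ℕP.+-identityʳ n)) (mulChain-supported c s (suc n)))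

chainProduct-supported : ∀ {r} (cs : Vec ℕ r) → SupportedOnℕ (chainProduct cs)
chainProduct-supported [] n = refl
chainProduct-supported (c ∷ cs) = mulChain-supported c (chainProduct-supported cs)

Palindromic : ℕ → Poly → Set
Palindromic e f = ∀ i → f i ≡ f (+ e - i)

mulChain-palindromic : ∀ c e {f : Poly} → Palindromic e f → Palindromic (e ℕ.+ c) (mulChain (suc c) f)
mulChain-palindromic zero e {f} p i =
  trans (ℤP.+-identityʳ (f i))
    (trans (p i) (trans (cong (λ z → f (+ z - i)) (sym (ℕP.+-identityʳ e))) (sym (ℤP.+-identityʳ _))))
mulChain-palindromic (suc c) e {f} p i =
  begin
    f i + mulChain (suc c) f (i - 1ℤ)
  ≡⟨ cong₂ _+_ (p i) (mulChain-palindromic c e p (i - 1ℤ)) ⟩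
    f (+ e - i) + mulChain (suc c) f (+ (e ℕ.+ c) - (i - 1ℤ))
  ≡⟨ cong₂ (λ a b → f a + mulChain (suc c) f b) (reflectˡ (+ e) i (+ c)) (reflectʳ (+ e) i (+ c)) ⟩
    f (j - + suc c) + mulChain (suc c) f j
  ≡⟨ ℤP.+-comm (f (j - + suc c)) _ ⟩
    mulChain (suc c) f j + f (j - + suc c)
  ≡⟨ sym (mulChain-suc (suc c) f j) ⟩
    mulChain (suc (suc c)) f j
  ∎
  where
  open ≡-Reasoning
  j = + (e ℕ.+ suc c) - i
  reflectˡ : ∀ e i c → e - i ≡ e + (1ℤ + c) - i - (1ℤ + c)
  reflectˡ = solve-∀
  reflectʳ : ∀ e i c → e + c - (i - 1ℤ) ≡ e + (1ℤ + c) - i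
  reflectʳ = solve-∀

1ₚ-palindromic : Palindromic 0 1ₚ
1ₚ-palindromic (+ zero) = refl
1ₚ-palindromic (+ suc n) = refl
1ₚ-palindromic -[1+ n ] = refl

chainProduct-palindromic : ∀ {r} (cs : Vec ℕ r) → Palindromic (chainDegree cs) (chainProduct cs)
chainProduct-palindromic [] = 1ₚ-palindromic
chainProduct-palindromic (zero ∷ cs) i = refl
chainProduct-palindromic (suc c ∷ cs) =
  subst (λ e → Palindromic e (chainProduct (suc c ∷ cs))) (ℕP.+-comm (chainDegree cs) c)
    (mulChain-palindromic c (chainDegree cs) (chainProduct-palindromic cs))

chainProduct-at-0 : ∀ {r} {cs : Vec ℕ r} → AllVec (1 ≤_) cs → chainProduct cs (+ 0) ≡ 1ℤ
chainProduct-at-0 [] = refl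
chainProduct-at-0 {cs = suc c ∷ cs} (s≤s _ ∷ ps) =
  cong₂ _+_ (chainProduct-at-0 ps) (mulChain-supported c (chainProduct-supported cs) 0)

chainProduct-at-degree : ∀ {r} {cs : Vec ℕ r} → AllVec (1 ≤_) cs → chainProduct cs (+ chainDegree cs) ≡ 1ℤ
chainProduct-at-degree {cs = cs} ps =
  trans (chainProduct-palindromic cs (+ chainDegree cs))
    (trans (cong (chainProduct cs) (ℤP.+-inverseʳ (+ chainDegree cs))) (chainProduct-at-0 ps))

Δ : Poly → Poly
Δ f i = f i - f (i - 1ℤ)

sum-Δ : ∀ c (f : Poly) i → ∑[ t < c ] Δ f (i - + toℕ t) ≡ f i - f (i - + c)
sum-Δ c f i =
  trans (sum-cong-≗ {c} (λ t → cong (λ j → f (i - + toℕ t) - f j) (i-t-1≡i-[1+t] i (+ toℕ t))))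
    (trans (telescope c (λ t → f (i - + t))) (cong (_- f (i - + c)) (cong f (ℤP.+-identityʳ i))))
  where
  i-t-1≡i-[1+t] : ∀ i t → i - t - 1ℤ ≡ i - (1ℤ + t)
  i-t-1≡i-[1+t] = solve-∀

≤ᵇ≡true⇒≤ : ∀ {m n} → (m ℕ.≤ᵇ n) ≡ true → m ≤ n
≤ᵇ≡true⇒≤ {m} {n} e = ℕP.≤ᵇ⇒≤ m n (Equivalence.from BP.T-≡ e)

≤⇒≤ᵇ≡true : ∀ {m n} → m ≤ n → (m ℕ.≤ᵇ n) ≡ true
≤⇒≤ᵇ≡true p = Equivalence.to BP.T-≡ (ℕP.≤⇒≤ᵇ p)

≤ᵇ≡false⇒> : ∀ {m n} → (m ℕ.≤ᵇ n) ≡ false → n < m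
≤ᵇ≡false⇒> e = ℕP.≰⇒> (λ p → BP.not-¬ (≤⇒≤ᵇ≡true p) e)

>⇒≤ᵇ≡false : ∀ {m n} → n < m → (m ℕ.≤ᵇ n) ≡ false
>⇒≤ᵇ≡false p = BP.¬-not (λ e → ℕP.<⇒≱ p (≤ᵇ≡true⇒≤ e))

≤ᵇ-suc : ∀ m n → (suc m ℕ.≤ᵇ suc n) ≡ (m ℕ.≤ᵇ n)
≤ᵇ-suc zero n = refl
≤ᵇ-suc (suc m) n = refl

≡ᵇ≡true⇒≡ : ∀ {m n} → (m ≡ᵇ n) ≡ true → m ≡ n
≡ᵇ≡true⇒≡ {m} {n} e = ℕP.≡ᵇ⇒≡ m n (Equivalence.from BP.T-≡ e)

≡ᵇ-refl : ∀ n → (n ≡ᵇ n) ≡ true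
≡ᵇ-refl n = Equivalence.to BP.T-≡ (ℕP.≡⇒≡ᵇ n n refl)

≡ᵇ-≢ : ∀ {m n} → m ≢ n → (m ≡ᵇ n) ≡ false
≡ᵇ-≢ m≢n = BP.¬-not (λ e → m≢n (≡ᵇ≡true⇒≡ e))

bit : Bool → ℕ
bit true = 1
bit false = 0

≡ᵇ-+ˡ : ∀ t m n → (t ℕ.+ m ≡ᵇ t ℕ.+ n) ≡ (m ≡ᵇ n)
≡ᵇ-+ˡ zero m n = refl
≡ᵇ-+ˡ (suc t) m n = ≡ᵇ-+ˡ t m n

+[m∸n]≡+m-+n : ∀ {m n} → n ≤ m → + (m ℕ.∸ n) ≡ + m - + n
+[m∸n]≡+m-+n {m} {n} n≤m = sym (trans (ℤP.m-n≡m⊖n m n) (ℤP.⊖-≥ n≤m))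

∧≡true⁺ : ∀ {a b} → a ≡ true → b ≡ true → a ∧ b ≡ true
∧≡true⁺ refl refl = refl

count-++ : ∀ {A : Set} (p : A → Bool) xs ys → countᵇ p (xs ++ ys) ≡ countᵇ p xs ℕ.+ countᵇ p ys
count-++ p [] ys = refl
count-++ p (x ∷ xs) ys with p x
... | true = cong suc (count-++ p xs ys)
... | false = count-++ p xs ys

count-map : ∀ {A B : Set} (p : B → Bool) (f : A → B) xs → countᵇ p (map f xs) ≡ countᵇ (p ∘ f) xs
count-map p f [] = refl
count-map p f (x ∷ xs) with p (f x)
... | true = cong suc (count-map p f xs)
... | false = count-map p f xs

count-filter : ∀ {A : Set} (p q : A → Bool) xs → countᵇ p (filterᵇ q xs) ≡ countᵇ (λ x → q x ∧ p x) xs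
count-filter p q [] = refl
count-filter p q (x ∷ xs) with q x
... | false = count-filter p q xs
... | true with p x
...   | true = cong suc (count-filter p q xs)
...   | false = count-filter p q xs

count-cong : ∀ {A : Set} {p q : A → Bool} → (∀ x → p x ≡ q x) → ∀ xs → countᵇ p xs ≡ countᵇ q xs
count-cong e [] = refl
count-cong {p = p} {q} e (x ∷ xs) with p x | q x | e x
... | true | .true | refl = cong suc (count-cong e xs)
... | false | .false | refl = count-cong e xs

count-none : ∀ {A : Set} {p : A → Bool} → (∀ x → p x ≡ false) → ∀ xs → countᵇ p xs ≡ 0
count-none e [] = refl
count-none {p = p} e (x ∷ xs) with p x | e x
... | .false | refl = count-none e xs

count-const∧ : ∀ {A : Set} (b : Bool) (p : A → Bool) xs →
  countᵇ (λ x → b ∧ p x) xs ≡ (if b then countᵇ p xs else 0)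
count-const∧ true p xs = refl
count-const∧ false p xs = count-none (λ _ → refl) xs

count-cartesian : ∀ {r} (p : Vec ℕ (suc r) → Bool) (h : ℕ → ℕ) c (ys : List (Vec ℕ r)) →
  + countᵇ p (cartesianProductWith _∷_ (applyUpTo h c) ys) ≡ ∑[ t < c ] (+ countᵇ (λ u → p (h (toℕ t) ∷ u)) ys)
count-cartesian p h zero ys = refl
count-cartesian p h (suc c) ys =
  begin
    + countᵇ p (map (h 0 ∷_) ys ++ rest)
  ≡⟨ cong +_ (count-++ p (map (h 0 ∷_) ys) rest) ⟩
    + (countᵇ p (map (h 0 ∷_) ys) ℕ.+ countᵇ p rest)
  ≡⟨ ℤP.pos-+ (countᵇ p (map (h 0 ∷_) ys)) (countᵇ p rest) ⟩
    + countᵇ p (map (h 0 ∷_) ys) + + countᵇ p rest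
  ≡⟨ cong₂ _+_ (cong +_ (count-map p (h 0 ∷_) ys)) (count-cartesian p (h ∘ suc) c ys) ⟩
    + countᵇ (λ u → p (h 0 ∷ u)) ys + ∑[ t < c ] (+ countᵇ (λ u → p (h (suc (toℕ t)) ∷ u)) ys)
  ∎
  where
  open ≡-Reasoning
  rest = cartesianProductWith _∷_ (applyUpTo (h ∘ suc) c) ys

not≡true⇒≡false : ∀ {b} → not b ≡ true → b ≡ false
not≡true⇒≡false {false} _ = refl

∧≡true⁻ : ∀ a {b} → a ∧ b ≡ true → a ≡ true × b ≡ true
∧≡true⁻ true {true} e = refl , refl

-- Standard monomials of a product of chains

box : ∀ {r} → Vec ℕ r → List (Vec ℕ r)
box [] = [] ∷ []
box (c ∷ cs) = cartesianProductWith _∷_ (upTo c) (box cs)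

-- The constraint 2 deg(u) + t ≤ chainDegree cs is the truncation that makes the Hilbert function
-- the first difference of the chain product up to the middle degree (see hilbert≡Δ-chainProduct).
isStandard : ∀ {r} → Vec ℕ r → Vec ℕ r → Bool
isStandard [] [] = true
isStandard (c ∷ cs) (t ∷ u) = (suc t ℕ.≤ᵇ c) ∧ ((2 ℕ.* degree u ℕ.+ t ℕ.≤ᵇ chainDegree cs) ∧ isStandard cs u)

standardMonomials : ∀ {r} → Vec ℕ r → List (Vec ℕ r)
standardMonomials cs = filterᵇ (isStandard cs) (box cs)

hilbert : ∀ {r} → Vec ℕ r → ℕ → ℕ
hilbert cs i = countᵇ (λ u → degree u ≡ᵇ i) (standardMonomials cs)

slice : ∀ {r} → ℕ → Vec ℕ r → ℕ → ℕ → ℕ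
slice c cs i t = countᵇ (λ u → isStandard (c ∷ cs) (t ∷ u) ∧ (degree (t ∷ u) ≡ᵇ i)) (box cs)

hilbert-∷ : ∀ {r} c (cs : Vec ℕ r) i → + hilbert (c ∷ cs) i ≡ ∑[ t < c ] (+ slice c cs i (toℕ t))
hilbert-∷ c cs i =
  trans (cong +_ (count-filter (λ u → degree u ≡ᵇ i) (isStandard (c ∷ cs)) (box (c ∷ cs))))
    (count-cartesian (λ u → isStandard (c ∷ cs) u ∧ (degree u ≡ᵇ i)) (λ t → t) c (box cs))

slice-≤ : ∀ {r} c (cs : Vec ℕ r) t k → t < c →
  slice c cs (t ℕ.+ k) t ≡ (if 2 ℕ.* k ℕ.+ t ℕ.≤ᵇ chainDegree cs then hilbert cs k else 0)
slice-≤ c cs t k t<c =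
  trans (count-cong select (box cs))
    (trans (count-const∧ (2 ℕ.* k ℕ.+ t ℕ.≤ᵇ chainDegree cs) _ (box cs))
      (cong (λ n → if 2 ℕ.* k ℕ.+ t ℕ.≤ᵇ chainDegree cs then n else 0)
        (sym (count-filter (λ u → degree u ≡ᵇ k) (isStandard cs) (box cs)))))
  where
  select : ∀ u → (isStandard (c ∷ cs) (t ∷ u) ∧ (degree (t ∷ u) ≡ᵇ t ℕ.+ k))
                 ≡ ((2 ℕ.* k ℕ.+ t ℕ.≤ᵇ chainDegree cs) ∧ (isStandard cs u ∧ (degree u ≡ᵇ k)))
  select u rewrite ≤⇒≤ᵇ≡true t<c | ≡ᵇ-+ˡ t (degree u) k with degree u ≡ᵇ k in eq
  ... | true = trans (cong (λ n → ((2 ℕ.* n ℕ.+ t ℕ.≤ᵇ chainDegree cs) ∧ isStandard cs u) ∧ true)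
                       (≡ᵇ≡true⇒≡ {degree u} {k} eq))
                     (BP.∧-assoc (2 ℕ.* k ℕ.+ t ℕ.≤ᵇ chainDegree cs) (isStandard cs u) true)
  ... | false = trans (BP.∧-zeroʳ ((2 ℕ.* degree u ℕ.+ t ℕ.≤ᵇ chainDegree cs) ∧ isStandard cs u))
                  (sym (trans (cong (b ∧_) (BP.∧-zeroʳ (isStandard cs u))) (BP.∧-zeroʳ b)))
    where
    b = 2 ℕ.* k ℕ.+ t ℕ.≤ᵇ chainDegree cs

slice-> : ∀ {r} c (cs : Vec ℕ r) t i → i < t → slice c cs i t ≡ 0
slice-> c cs t i i<t = count-none (λ u → trans (cong (isStandard (c ∷ cs) (t ∷ u) ∧_) (t+n≢i u))
                                                 (BP.∧-zeroʳ (isStandard (c ∷ cs) (t ∷ u)))) (box cs)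
  where
  t+n≢i : ∀ u → (t ℕ.+ degree u ≡ᵇ i) ≡ false
  t+n≢i u = BP.¬-not (λ e → ℕP.<⇒≱ i<t (ℕP.≤-trans (ℕP.m≤m+n t (degree u)) (ℕP.≤-reflexive (≡ᵇ≡true⇒≡ e))))

2k+t≤ᵇE≡2[t+k]∸E≤ᵇt : ∀ t k E → (2 ℕ.* k ℕ.+ t ℕ.≤ᵇ E) ≡ (2 ℕ.* (t ℕ.+ k) ℕ.∸ E ℕ.≤ᵇ t)
2k+t≤ᵇE≡2[t+k]∸E≤ᵇt t k E with 2 ℕ.* k ℕ.+ t ℕ.≤ᵇ E in e₁ | 2 ℕ.* (t ℕ.+ k) ℕ.∸ E ℕ.≤ᵇ t in e₂
... | true | true = refl
... | false | false = refl
... | true | false = contradiction (⇒ (≤ᵇ≡true⇒≤ e₁)) (ℕP.<⇒≱ (≤ᵇ≡false⇒> e₂))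
  where
  ⇒ : 2 ℕ.* k ℕ.+ t ≤ E → 2 ℕ.* (t ℕ.+ k) ℕ.∸ E ≤ t
  ⇒ p = ℕP.m≤n+o⇒m∸n≤o (2 ℕ.* (t ℕ.+ k)) E (subst (_≤ E ℕ.+ t) (twice t k) (ℕP.+-monoˡ-≤ t p))
    where
    twice : ∀ t k → 2 ℕ.* k ℕ.+ t ℕ.+ t ≡ 2 ℕ.* (t ℕ.+ k)
    twice = NatSolver.solve-∀
... | false | true = contradiction (⇐ (≤ᵇ≡true⇒≤ e₂)) (ℕP.<⇒≱ (≤ᵇ≡false⇒> e₁))
  where
  ⇐ : 2 ℕ.* (t ℕ.+ k) ℕ.∸ E ≤ t → 2 ℕ.* k ℕ.+ t ≤ E
  ⇐ p = ℕP.+-cancelʳ-≤ t _ _ (subst (_≤ E ℕ.+ t) (twice t k)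
          (ℕP.≤-trans (ℕP.m≤n+m∸n (2 ℕ.* (t ℕ.+ k)) E) (ℕP.+-monoʳ-≤ E p)))
    where
    twice : ∀ t k → 2 ℕ.* (t ℕ.+ k) ≡ 2 ℕ.* k ℕ.+ t ℕ.+ t
    twice = NatSolver.solve-∀

sum-from : ∀ c T (g : ℕ → ℤ) → T ≤ c →
  ∑[ t < c ] (if T ℕ.≤ᵇ toℕ t then g (toℕ t) else 0ℤ) ≡ ∑[ t < c ] g (toℕ t) - ∑[ t < T ] g (toℕ t)
sum-from c zero g _ = sym (ℤP.+-identityʳ _)
sum-from (suc c) (suc T) g (s≤s T≤c) =
  begin
    0ℤ + ∑[ t < c ] (if suc T ℕ.≤ᵇ suc (toℕ t) then g (suc (toℕ t)) else 0ℤ)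
  ≡⟨ ℤP.+-identityˡ _ ⟩
    ∑[ t < c ] (if suc T ℕ.≤ᵇ suc (toℕ t) then g (suc (toℕ t)) else 0ℤ)
  ≡⟨ sum-cong-≗ {c} (λ t → cong (λ b → if b then g (suc (toℕ t)) else 0ℤ) (≤ᵇ-suc T (toℕ t))) ⟩
    ∑[ t < c ] (if T ℕ.≤ᵇ toℕ t then g (suc (toℕ t)) else 0ℤ)
  ≡⟨ sum-from c T (g ∘ suc) T≤c ⟩
    ∑[ t < c ] g (suc (toℕ t)) - ∑[ t < T ] g (suc (toℕ t))
  ≡⟨ cancel (g 0) _ _ ⟩
    (g 0 + ∑[ t < c ] g (suc (toℕ t))) - (g 0 + ∑[ t < T ] g (suc (toℕ t)))
  ∎
  where
  open ≡-Reasoning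
  cancel : ∀ a x y → x - y ≡ (a + x) - (a + y)
  cancel = solve-∀

palindromic-window : ∀ {E} {Q : Poly} → Palindromic E Q → ∀ i → ∑[ t < 2 ℕ.* i ℕ.∸ E ] Δ Q (+ i - + toℕ t) ≡ 0ℤ
palindromic-window {E} {Q} pal i with 2 ℕ.* i ℕP.≤? E
... | yes 2i≤E rewrite ℕP.m≤n⇒m∸n≡0 2i≤E = refl
... | no 2i≰E =
  begin
    ∑[ t < T ] Δ Q (+ i - + toℕ t)
  ≡⟨ sum-Δ T Q (+ i) ⟩
    Q (+ i) - Q (+ i - + T)
  ≡⟨ cong (λ j → Q (+ i) - Q j) i-T≡E-i ⟩
    Q (+ i) - Q (+ E - + i)
  ≡⟨ cong (_-_ (Q (+ i))) (sym (pal (+ i))) ⟩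
    Q (+ i) - Q (+ i)
  ≡⟨ ℤP.+-inverseʳ (Q (+ i)) ⟩
    0ℤ
  ∎
  where
  open ≡-Reasoning
  T = 2 ℕ.* i ℕ.∸ E
  i-T≡E-i : + i - + T ≡ + E - + i
  i-T≡E-i = trans (cong (_-_ (+ i)) (+[m∸n]≡+m-+n (ℕP.<⇒≤ (ℕP.≰⇒> 2i≰E)))) (reflect (+ i) (+ E))
    where
    reflect : ∀ i E → i - ((i + (i + 0ℤ)) - E) ≡ E - i
    reflect = solve-∀

Δ-below-0 : ∀ {f} → SupportedOnℕ f → ∀ {i t} → i < t → Δ f (+ i - + t) ≡ 0ℤ
Δ-below-0 {f} supp {i} i<t with ℕP.m≤n⇒∃[o]m+o≡n i<t
... | k , refl = trans (cong₂ (λ a b → f a - f b) (i-[1+i+k] (+ i) (+ k)) (i-[1+i+k]-1 (+ i) (+ k)))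
                   (cong₂ _-_ (supp k) (supp (suc k)))
  where
  i-[1+i+k] : ∀ i k → i - (1ℤ + i + k) ≡ - (1ℤ + k)
  i-[1+i+k] = solve-∀
  i-[1+i+k]-1 : ∀ i k → i - (1ℤ + i + k) - 1ℤ ≡ - (1ℤ + (1ℤ + k))
  i-[1+i+k]-1 = solve-∀

slice≡truncatedΔ : ∀ {r} c (cs : Vec ℕ r) i →
  (∀ k → 2 ℕ.* k ≤ suc (chainDegree cs) → + hilbert cs k ≡ Δ (chainProduct cs) (+ k)) →
  ∀ t → t < c →
  + slice c cs i t ≡ (if 2 ℕ.* i ℕ.∸ chainDegree cs ℕ.≤ᵇ t then Δ (chainProduct cs) (+ i - + t) else 0ℤ)
slice≡truncatedΔ c cs i ih t t<c with t ℕP.≤? i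
... | no t≰i = trans (cong +_ (slice-> c cs t i (ℕP.≰⇒> t≰i)))
                  (sym (if-zero (2 ℕ.* i ℕ.∸ chainDegree cs ℕ.≤ᵇ t)
                         (Δ-below-0 {chainProduct cs} (chainProduct-supported cs) (ℕP.≰⇒> t≰i))))
  where
  if-zero : ∀ b {x} → x ≡ 0ℤ → (if b then x else 0ℤ) ≡ 0ℤ
  if-zero true x≡0 = x≡0
  if-zero false _ = refl
... | yes t≤i with ℕP.m≤n⇒∃[o]m+o≡n t≤i
...   | k , refl rewrite slice-≤ c cs t k t<c | sym (2k+t≤ᵇE≡2[t+k]∸E≤ᵇt t k (chainDegree cs))
          with 2 ℕ.* k ℕ.+ t ℕ.≤ᵇ chainDegree cs in 2k+t≤ᵇE
...     | true = trans (ih k 2k≤1+E) (cong (Δ (chainProduct cs)) (sym (t+k-t≡k (+ t) (+ k))))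
  where
  2k≤1+E : 2 ℕ.* k ≤ suc (chainDegree cs)
  2k≤1+E = ℕP.m≤n⇒m≤1+n (ℕP.≤-trans (ℕP.m≤m+n (2 ℕ.* k) t) (≤ᵇ≡true⇒≤ 2k+t≤ᵇE))
  t+k-t≡k : ∀ t k → t + k - t ≡ k
  t+k-t≡k = solve-∀
...     | false = refl

-- Writing P = [c] Q with Q palindromic of degree E, the slices of standard monomials with first
-- exponent t ≥ 2i ∸ E contribute Δ Q (i - t); the omitted terms t < 2i ∸ E sum to zero by palindromy.
hilbert≡Δ-chainProduct : ∀ {r} (cs : Vec ℕ r) i → 2 ℕ.* i ≤ suc (chainDegree cs) →
  + hilbert cs i ≡ Δ (chainProduct cs) (+ i)
hilbert≡Δ-chainProduct [] zero _ = refl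
hilbert≡Δ-chainProduct [] (suc zero) (s≤s ())
hilbert≡Δ-chainProduct [] (suc (suc i)) (s≤s ())
hilbert≡Δ-chainProduct (zero ∷ cs) i _ = refl
hilbert≡Δ-chainProduct (suc c ∷ cs) i 2i≤1+deg =
  begin
    + hilbert (suc c ∷ cs) i
  ≡⟨ hilbert-∷ (suc c) cs i ⟩
    ∑[ t < suc c ] (+ slice (suc c) cs i (toℕ t))
  ≡⟨ sum-cong-≗ {suc c} (λ t → slice≡truncatedΔ (suc c) cs i (hilbert≡Δ-chainProduct cs) (toℕ t) (FinP.toℕ<n t)) ⟩
    ∑[ t < suc c ] (if T ℕ.≤ᵇ toℕ t then g (toℕ t) else 0ℤ)
  ≡⟨ sum-from (suc c) T g T≤1+c ⟩
    ∑[ t < suc c ] g (toℕ t) - ∑[ t < T ] g (toℕ t)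
  ≡⟨ cong₂ _-_ (sum-Δ (suc c) Q (+ i)) (palindromic-window (chainProduct-palindromic cs) i) ⟩
    Q (+ i) - Q (+ i - + suc c) - 0ℤ
  ≡⟨ ℤP.+-identityʳ _ ⟩
    Q (+ i) - Q (+ i - + suc c)
  ≡⟨ sym (mulChain-difference (suc c) Q (+ i)) ⟩
    Δ (chainProduct (suc c ∷ cs)) (+ i)
  ∎
  where
  open ≡-Reasoning
  Q = chainProduct cs
  T = 2 ℕ.* i ℕ.∸ chainDegree cs
  g : ℕ → ℤ
  g t = Δ Q (+ i - + t)
  T≤1+c : T ≤ suc c
  T≤1+c = ℕP.m≤n+o⇒m∸n≤o (2 ℕ.* i) (chainDegree cs) (subst (2 ℕ.* i ≤_) (ℕP.+-comm (suc c) (chainDegree cs)) 2i≤1+deg)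

box-unique : ∀ {r} (cs : Vec ℕ r) → Unique (box cs)
box-unique [] = AllList.[] AllPairs.∷ AllPairs.[]
box-unique (c ∷ cs) = UniqueP.cartesianProductWith⁺ _∷_ VP.∷-injective (UniqueP.upTo⁺ c) (box-unique cs)

∈-box⁺ : ∀ {r} {cs u : Vec ℕ r} → Pointwise _<_ u cs → u ∈ box cs
∈-box⁺ [] = Any.here refl
∈-box⁺ (p ∷ ps) = ∈P.∈-cartesianProductWith⁺ _∷_ (∈P.∈-upTo⁺ p) (∈-box⁺ ps)

∈-box⁻ : ∀ {r} (cs u : Vec ℕ r) → u ∈ box cs → Pointwise _<_ u cs
∈-box⁻ [] [] _ = []
∈-box⁻ (c ∷ cs) u u∈ with ∈P.∈-cartesianProductWith⁻ _∷_ (upTo c) (box cs) u∈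
... | t , v , t∈ , v∈ , refl = ∈P.∈-upTo⁻ t∈ ∷ ∈-box⁻ cs v v∈

degree-mono : ∀ {r} {u v : Vec ℕ r} → Pointwise _≤_ v u → degree v ≤ degree u
degree-mono [] = z≤n
degree-mono (p ∷ ps) = ℕP.+-mono-≤ p (degree-mono ps)

isStandard-downward : ∀ {r} (cs : Vec ℕ r) {u v} → Pointwise _≤_ v u → isStandard cs u ≡ true → isStandard cs v ≡ true
isStandard-downward [] [] _ = refl
isStandard-downward (c ∷ cs) {t ∷ u} {s ∷ v} (s≤t ∷ v≤u) std
  with suc t ℕ.≤ᵇ c in t<c | 2 ℕ.* degree u ℕ.+ t ℕ.≤ᵇ chainDegree cs in bound | isStandard cs u in u-std
... | true | true | true =
  ∧≡true⁺ (≤⇒≤ᵇ≡true {suc s} {c} (ℕP.≤-trans (s≤s s≤t) (≤ᵇ≡true⇒≤ {suc t} t<c)))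
    (∧≡true⁺ (≤⇒≤ᵇ≡true {2 ℕ.* degree v ℕ.+ s}
               (ℕP.≤-trans (ℕP.+-mono-≤ (ℕP.*-monoʳ-≤ 2 (degree-mono v≤u)) s≤t) (≤ᵇ≡true⇒≤ bound)))
      (isStandard-downward cs v≤u u-std))

standardMonomials-unique : ∀ {r} (cs : Vec ℕ r) → Unique (standardMonomials cs)
standardMonomials-unique cs = UniqueP.filter⁺ (T? ∘ isStandard cs) (box-unique cs)

standardMonomials-downward : ∀ {r} (cs : Vec ℕ r) u v → u ∈ standardMonomials cs → Pointwise _≤_ v u →
  v ∈ standardMonomials cs
standardMonomials-downward cs u v u∈ v≤u with ∈P.∈-filter⁻ (T? ∘ isStandard cs) {xs = box cs} u∈
... | u∈box , u-std =
  ∈P.∈-filter⁺ (T? ∘ isStandard cs) (∈-box⁺ (≤-<-pointwise v≤u (∈-box⁻ cs u u∈box)))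
    (Equivalence.from BP.T-≡ (isStandard-downward cs v≤u (Equivalence.to BP.T-≡ u-std)))
  where
  ≤-<-pointwise : ∀ {r} {v u w : Vec ℕ r} → Pointwise _≤_ v u → Pointwise _<_ u w → Pointwise _<_ v w
  ≤-<-pointwise [] [] = []
  ≤-<-pointwise (p ∷ ps) (q ∷ qs) = ℕP.≤-<-trans p q ∷ ≤-<-pointwise ps qs

0∈standardMonomials : ∀ {r} {cs : Vec ℕ r} → AllVec (1 ≤_) cs → Vec.replicate r 0 ∈ standardMonomials cs
0∈standardMonomials {r} {cs} cs-pos =
  ∈P.∈-filter⁺ (T? ∘ isStandard cs) (∈-box⁺ (0<cs cs-pos)) (Equivalence.from BP.T-≡ (0-standard cs-pos))
  where
  0<cs : ∀ {r} {cs : Vec ℕ r} → AllVec (1 ≤_) cs → Pointwise _<_ (Vec.replicate r 0) cs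
  0<cs [] = []
  0<cs (p ∷ ps) = p ∷ 0<cs ps
  degree-0 : ∀ r → degree (Vec.replicate r 0) ≡ 0
  degree-0 zero = refl
  degree-0 (suc r) = degree-0 r
  0-standard : ∀ {r} {cs : Vec ℕ r} → AllVec (1 ≤_) cs → isStandard cs (Vec.replicate r 0) ≡ true
  0-standard [] = refl
  0-standard {suc r} (p ∷ ps) rewrite ≤⇒≤ᵇ≡true p | degree-0 r | 0-standard ps = refl

hilbert-isMVector : ∀ {r} L (cs : Vec ℕ r) → AllVec (1 ≤_) cs → IsMVector L (hilbert cs)
hilbert-isMVector {r} L cs cs-pos =
  r , standardMonomials cs , standardMonomials-unique cs , 0∈standardMonomials cs-pos ,
  (λ u v → standardMonomials-downward cs u v) , (λ i _ → refl)

allᶠ : ∀ {n} → (Fin n → Bool) → Bool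
allᶠ {zero} p = true
allᶠ {suc n} p = p zero ∧ allᶠ (p ∘ suc)

anyᶠ : ∀ {n} → (Fin n → Bool) → Bool
anyᶠ {zero} p = false
anyᶠ {suc n} p = p zero ∨ anyᶠ (p ∘ suc)

allᶠ-cong : ∀ {n} {p q : Fin n → Bool} → (∀ x → p x ≡ q x) → allᶠ p ≡ allᶠ q
allᶠ-cong {zero} e = refl
allᶠ-cong {suc n} e = cong₂ _∧_ (e zero) (allᶠ-cong (e ∘ suc))

all-tabulate : ∀ {n} {A : Set} (p : A → Bool) (f : Fin n → A) → all p (List.tabulate f) ≡ allᶠ (p ∘ f)
all-tabulate {zero} p f = refl
all-tabulate {suc n} p f = cong (p (f zero) ∧_) (all-tabulate p (f ∘ suc))

any-tabulate : ∀ {n} {A : Set} (p : A → Bool) (f : Fin n → A) → any p (List.tabulate f) ≡ anyᶠ (p ∘ f)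
any-tabulate {zero} p f = refl
any-tabulate {suc n} p f = cong (p (f zero) ∨_) (any-tabulate p (f ∘ suc))

allᶠ-elim : ∀ {n} {p : Fin n → Bool} → allᶠ p ≡ true → ∀ x → p x ≡ true
allᶠ-elim {suc n} {p} e zero with p zero | e
... | true | _ = refl
allᶠ-elim {suc n} {p} e (suc x) with p zero | e
... | true | e′ = allᶠ-elim {p = p ∘ suc} e′ x

allᶠ-intro : ∀ {n} {p : Fin n → Bool} → (∀ x → p x ≡ true) → allᶠ p ≡ true
allᶠ-intro {zero} h = refl
allᶠ-intro {suc n} {p} h rewrite h zero = allᶠ-intro (h ∘ suc)

allᶠ-false-elim : ∀ {n} {p : Fin n → Bool} → allᶠ p ≡ false → ∃[ x ] p x ≡ false
allᶠ-false-elim {suc n} {p} e with p zero in eq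
... | false = zero , eq
... | true with allᶠ-false-elim {p = p ∘ suc} e
... | x , q = suc x , q

allᶠ-false-intro : ∀ {n} {p : Fin n → Bool} x → p x ≡ false → allᶠ p ≡ false
allᶠ-false-intro {suc n} {p} zero e rewrite e = refl
allᶠ-false-intro {suc n} {p} (suc x) e with p zero
... | true = allᶠ-false-intro {p = p ∘ suc} x e
... | false = refl

anyᶠ-elim : ∀ {n} {p : Fin n → Bool} → anyᶠ p ≡ true → ∃[ x ] p x ≡ true
anyᶠ-elim {suc n} {p} e with p zero in eq
... | true = zero , eq
... | false with anyᶠ-elim {p = p ∘ suc} e
... | x , q = suc x , q

anyᶠ-intro : ∀ {n} {p : Fin n → Bool} x → p x ≡ true → anyᶠ p ≡ true
anyᶠ-intro {suc n} {p} zero e rewrite e = refl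
anyᶠ-intro {suc n} {p} (suc x) e with p zero
... | true = refl
... | false = anyᶠ-intro {p = p ∘ suc} x e

anyᶠ-false-intro : ∀ {n} {p : Fin n → Bool} → (∀ x → p x ≡ false) → anyᶠ p ≡ false
anyᶠ-false-intro {zero} h = refl
anyᶠ-false-intro {suc n} {p} h rewrite h zero = anyᶠ-false-intro (h ∘ suc)

-- Joins σ * ∂σ₁ * ⋯ * ∂σₖ

isApex : ∀ {k} → Label k → Bool
isApex apex = true
isApex unused = false
isApex (block _) = false

isApex-true : ∀ {k} (l : Label k) → isApex l ≡ true → l ≡ apex
isApex-true apex _ = refl

isBlock-true : ∀ {k} (β : Fin k) l → isBlock β l ≡ true → l ≡ block β
isBlock-true β (block γ) _ with β FinP.≟ γ
... | yes refl = refl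

isBlock-self : ∀ {k} (β : Fin k) → isBlock β (block β) ≡ true
isBlock-self β with β FinP.≟ β
... | yes _ = refl
... | no β≢β = contradiction refl β≢β

isBlock-other : ∀ {k} (γ β : Fin k) → γ ≢ β → isBlock γ (block β) ≡ false
isBlock-other γ β γ≢β with γ FinP.≟ β
... | yes γ≡β = contradiction γ≡β γ≢β
... | no _ = refl

blockSize : ∀ {n k} → (Fin n → Label k) → Fin k → ℕ
blockSize {zero} lab β = 0
blockSize {suc n} lab β = bit (isBlock β (lab zero)) ℕ.+ blockSize (lab ∘ suc) β

apexSize : ∀ {n k} → (Fin n → Label k) → ℕ
apexSize {zero} lab = 0
apexSize {suc n} lab = bit (isApex (lab zero)) ℕ.+ apexSize (lab ∘ suc)

blockSize-0 : ∀ {n k} (lab : Fin n → Label k) β → blockSize lab β ≡ 0 → ∀ x → isBlock β (lab x) ≡ false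
blockSize-0 {suc n} lab β empty x with isBlock β (lab zero) in x₀∉β
blockSize-0 {suc n} lab β empty zero | false = x₀∉β
blockSize-0 {suc n} lab β empty (suc x) | false = blockSize-0 (lab ∘ suc) β empty x

blockSize-pos : ∀ {n k} (lab : Fin n → Label k) β x → lab x ≡ block β → 1 ≤ blockSize lab β
blockSize-pos {suc n} lab β zero x∈β rewrite x∈β | isBlock-self β = s≤s z≤n
blockSize-pos {suc n} lab β (suc x) x∈β = ℕP.≤-trans (blockSize-pos (lab ∘ suc) β x x∈β) (ℕP.m≤n+m _ _)

apexSize-0 : ∀ {n k} (lab : Fin n → Label k) → (∀ x → lab x ≢ apex) → apexSize lab ≡ 0
apexSize-0 {zero} lab _ = refl
apexSize-0 {suc n} lab no-apex with lab zero in x₀-label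
... | unused = apexSize-0 (lab ∘ suc) (no-apex ∘ suc)
... | apex = contradiction x₀-label (no-apex zero)
... | block _ = apexSize-0 (lab ∘ suc) (no-apex ∘ suc)

apexSize-pos : ∀ {n k} (lab : Fin n → Label k) x → lab x ≡ apex → 1 ≤ apexSize lab
apexSize-pos {suc n} lab zero x-apex rewrite x-apex = s≤s z≤n
apexSize-pos {suc n} lab (suc x) x-apex = ℕP.≤-trans (apexSize-pos (lab ∘ suc) x x-apex) (ℕP.m≤n+m _ _)

-- isJoinFace lab missed interior F: F is a face of the join labelled by lab, where the blocks with
-- missed β are already known to miss a vertex; if interior, F must moreover contain the apex σ.
-- The flags make the definition amenable to recursion over the vertices.
allowed : ∀ {k} → Bool → Label k → Bool → Bool
allowed interior unused x∈F = not x∈F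
allowed interior apex x∈F = not interior ∨ x∈F
allowed interior (block _) x∈F = true

isJoinFace : ∀ {n k} → (Fin n → Label k) → (Fin k → Bool) → Bool → Subset n → Bool
isJoinFace lab missed interior F =
  allᶠ (λ x → allowed interior (lab x) (lookup F x))
  ∧ allᶠ (λ β → missed β ∨ anyᶠ (λ x → isBlock β (lab x) ∧ not (lookup F x)))

noneMissed : ∀ {k} → Fin k → Bool
noneMissed _ = false

missedAfter : ∀ {k} → (Fin k → Bool) → Label k → Bool → Fin k → Bool
missedAfter missed l x∈F β = missed β ∨ (isBlock β l ∧ not x∈F)

markMissed : ∀ {k} → (Fin k → Bool) → Fin k → Fin k → Bool
markMissed missed β γ = missed γ ∨ isBlock γ (block β)

missedAfter-true : ∀ {k} (missed : Fin k → Bool) l γ → missedAfter missed l true γ ≡ missed γ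
missedAfter-true missed l γ = trans (cong (missed γ ∨_) (BP.∧-zeroʳ (isBlock γ l))) (BP.∨-identityʳ (missed γ))

missedAfter-unused : ∀ {k} (missed : Fin k → Bool) b γ → missedAfter missed unused b γ ≡ missed γ
missedAfter-unused missed b γ = BP.∨-identityʳ (missed γ)

missedAfter-apex : ∀ {k} (missed : Fin k → Bool) b γ → missedAfter missed apex b γ ≡ missed γ
missedAfter-apex missed b γ = BP.∨-identityʳ (missed γ)

missedAfter-false : ∀ {k} (missed : Fin k → Bool) β γ → missedAfter missed (block β) false γ ≡ markMissed missed β γ
missedAfter-false missed β γ = cong (missed γ ∨_) (BP.∧-identityʳ _)

missedAfter-missed : ∀ {k} (missed : Fin k → Bool) β b → missed β ≡ true → ∀ γ → missedAfter missed (block β) b γ ≡ missed γ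
missedAfter-missed missed β b β-missed γ with γ FinP.≟ β
... | yes refl rewrite β-missed = refl
... | no _ = BP.∨-identityʳ (missed γ)

isJoinFace-∷ : ∀ {n k} (lab : Fin (suc n) → Label k) missed interior b (F : Subset n) →
  isJoinFace lab missed interior (b ∷ F)
  ≡ allowed interior (lab zero) b ∧ isJoinFace (lab ∘ suc) (missedAfter missed (lab zero) b) interior F
isJoinFace-∷ lab missed interior b F =
  trans (BP.∧-assoc (allowed interior (lab zero) b) _ _)
    (cong (λ z → allowed interior (lab zero) b ∧ (allᶠ (λ x → allowed interior (lab (suc x)) (lookup F x)) ∧ z))
      (allᶠ-cong (λ β → sym (BP.∨-assoc (missed β) _ _))))

isJoinFace-cong : ∀ {n k} (lab : Fin n → Label k) {missed missed′ : Fin k → Bool} interior →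
  (∀ β → missed β ≡ missed′ β) → ∀ F → isJoinFace lab missed interior F ≡ isJoinFace lab missed′ interior F
isJoinFace-cong lab interior missed≡ F = cong (allᶠ (λ x → allowed interior (lab x) (lookup F x)) ∧_)
  (allᶠ-cong (λ β → cong (_∨ anyᶠ (λ x → isBlock β (lab x) ∧ not (lookup F x))) (missed≡ β)))

isJoinFace-blockless : ∀ {n k} (lab : Fin n → Label k) missed interior β → missed β ≡ false → blockSize lab β ≡ 0 →
  ∀ F → isJoinFace lab missed interior F ≡ false
isJoinFace-blockless lab missed interior β β-fresh β-empty F =
  trans (cong (allᶠ (λ x → allowed interior (lab x) (lookup F x)) ∧_)
          (allᶠ-false-intro β (trans (cong (_∨ _) β-fresh)
             (anyᶠ-false-intro (λ x → cong (_∧ not (lookup F x)) (blockSize-0 lab β β-empty x))))))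
    (BP.∧-zeroʳ _)

joinComplex≡isJoinFace : ∀ {n} (J : PSJoin n) F → joinComplex J F ≡ isJoinFace (lab J) noneMissed false F
joinComplex≡isJoinFace {n} J F =
  cong₂ _∧_
    (trans (all-tabulate (λ x → not (x ∈ᵇ F) ∨ not (isUnused (lab J x))) (λ (x : Fin n) → x))
      (allᶠ-cong (λ x → allowed≡ (lab J x) (lookup F x))))
    (trans (all-tabulate (λ β → any (λ x → isBlock β (lab J x) ∧ not (x ∈ᵇ F)) (allFin n)) (λ (β : Fin (k J)) → β))
      (allᶠ-cong (λ β → any-tabulate (λ x → isBlock β (lab J x) ∧ not (x ∈ᵇ F)) (λ (x : Fin n) → x))))
  where
  allowed≡ : ∀ (l : Label (k J)) b → (not b ∨ not (isUnused l)) ≡ allowed false l b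
  allowed≡ unused b = BP.∨-identityʳ (not b)
  allowed≡ apex b = BP.∨-zeroʳ (not b)
  allowed≡ (block _) b = BP.∨-zeroʳ (not b)

facetSizeStep : ∀ {k} → Label k → ((Fin k → Bool) → ℕ) → (Fin k → Bool) → ℕ
facetSizeStep unused r missed = r missed
facetSizeStep apex r missed = suc (r missed)
facetSizeStep (block β) r missed = if missed β then suc (r missed) else r (markMissed missed β)

facetSize : ∀ {n k} → (Fin n → Label k) → (Fin k → Bool) → ℕ
facetSize {zero} lab missed = 0
facetSize {suc n} lab missed = facetSizeStep (lab zero) (facetSize (lab ∘ suc)) missed

blockShare : Bool → ℕ → ℕ
blockShare true a = a
blockShare false a = a ℕ.∸ 1

sumℕ-suc-at : ∀ k (f g : Fin k → ℕ) β → f β ≡ suc (g β) → (∀ γ → γ ≢ β → f γ ≡ g γ) →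
  sumℕ {k} f ≡ suc (sumℕ {k} g)
sumℕ-suc-at (suc k) f g zero fβ≡ f≡g =
  cong₂ ℕ._+_ fβ≡ (sumℕ-cong-≗ {k} (λ γ → f≡g (suc γ) (λ ())))
sumℕ-suc-at (suc k) f g (suc β) fβ≡ f≡g =
  trans (cong₂ ℕ._+_ (f≡g zero (λ ()))
          (sumℕ-suc-at k (f ∘ suc) (g ∘ suc) β fβ≡ (λ γ γ≢β → f≡g (suc γ) (γ≢β ∘ FinP.suc-injective))))
    (ℕP.+-suc (g zero) _)

-- Every vertex of σ and of a missed block lies on a facet; an unmissed block drops one vertex.
facetSize-closed : ∀ {n k} (lab : Fin n → Label k) missed →
  facetSize lab missed ≡ apexSize lab ℕ.+ sumℕ {k} (λ β → blockShare (missed β) (blockSize lab β))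
facetSize-closed {zero} {k} lab missed =
  sym (trans (sumℕ-cong-≗ {k} (λ β → blockShare-0 (missed β))) (sumℕ-zero k))
  where
  blockShare-0 : ∀ b → blockShare b 0 ≡ 0
  blockShare-0 true = refl
  blockShare-0 false = refl
facetSize-closed {suc n} {k} lab missed = by-label (lab zero) refl
  where
  rest = lab ∘ suc
  by-label : ∀ l → lab zero ≡ l →
    facetSizeStep l (facetSize rest) missed ≡ apexSize lab ℕ.+ sumℕ {k} (λ β → blockShare (missed β) (blockSize lab β))
  by-label unused x₀-label rewrite x₀-label = facetSize-closed rest missed
  by-label apex x₀-label rewrite x₀-label = cong suc (facetSize-closed rest missed)
  by-label (block β) x₀-label with missed β in β-missed
  ... | true rewrite x₀-label =
    trans (cong suc (facetSize-closed rest missed))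
      (sym (trans (cong (apexSize rest ℕ.+_) (sumℕ-suc-at k _ _ β at-β off-β)) (ℕP.+-suc (apexSize rest) _)))
    where
    at-β : blockShare (missed β) (bit (isBlock β (block β)) ℕ.+ blockSize rest β) ≡ suc (blockShare (missed β) (blockSize rest β))
    at-β rewrite β-missed | isBlock-self β = refl
    off-β : ∀ γ → γ ≢ β →
      blockShare (missed γ) (bit (isBlock γ (block β)) ℕ.+ blockSize rest γ) ≡ blockShare (missed γ) (blockSize rest γ)
    off-β γ γ≢β rewrite isBlock-other γ β γ≢β = refl
  ... | false rewrite x₀-label =
    trans (facetSize-closed rest (markMissed missed β)) (cong (apexSize rest ℕ.+_) (sumℕ-cong-≗ {k} shares))
    where
    shares : ∀ γ →
      blockShare (markMissed missed β γ) (blockSize rest γ) ≡ blockShare (missed γ) (bit (isBlock γ (block β)) ℕ.+ blockSize rest γ)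
    shares γ with γ FinP.≟ β
    ... | yes refl rewrite β-missed = refl
    ... | no _ = cong (λ b → blockShare b (blockSize rest γ)) (BP.∨-identityʳ (missed γ))

markMissed-facetSize : ∀ {n k} (rest : Fin n → Label k) missed β → missed β ≡ false →
  (blockSize rest β ≡ 0) ⊎ (facetSize rest (markMissed missed β) ≡ suc (facetSize rest missed))
markMissed-facetSize {n} {k} rest missed β β-fresh with blockSize rest β in β-size
... | zero = inj₁ refl
... | suc _ = inj₂ (trans (facetSize-closed rest (markMissed missed β))
        (trans (cong (apexSize rest ℕ.+_) (sumℕ-suc-at k _ _ β at-β off-β))
          (trans (ℕP.+-suc (apexSize rest) _) (cong suc (sym (facetSize-closed rest missed))))))
  where
  at-β : blockShare (markMissed missed β β) (blockSize rest β) ≡ suc (blockShare (missed β) (blockSize rest β))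
  at-β rewrite β-fresh | isBlock-self β | β-size = refl
  off-β : ∀ γ → γ ≢ β → blockShare (markMissed missed β γ) (blockSize rest γ) ≡ blockShare (missed γ) (blockSize rest γ)
  off-β γ γ≢β rewrite isBlock-other γ β γ≢β | BP.∨-identityʳ (missed γ) = refl

∣∷∣≤ : ∀ {n} b (F : Subset n) → ∣ b ∷ F ∣ ≤ suc ∣ F ∣
∣∷∣≤ true F = ℕP.≤-refl
∣∷∣≤ false F = ℕP.n≤1+n _

joinFace-size≤facetSize : ∀ {n k} (lab : Fin n → Label k) missed interior F →
  isJoinFace lab missed interior F ≡ true → ∣ F ∣ ≤ facetSize lab missed
joinFace-size≤facetSize {zero} lab missed interior [] _ = z≤n
joinFace-size≤facetSize {suc n} lab missed interior (b ∷ F) face =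
  by-label (lab zero) b (trans (sym (isJoinFace-∷ lab missed interior b F)) face)
  where
  rest = lab ∘ suc
  rest-face : ∀ {missed′} l b → (∀ γ → missedAfter missed l b γ ≡ missed′ γ) →
    allowed interior l b ∧ isJoinFace rest (missedAfter missed l b) interior F ≡ true → isJoinFace rest missed′ interior F ≡ true
  rest-face l b missed≡ face′ = trans (sym (isJoinFace-cong rest interior missed≡ F)) (proj₂ (∧≡true⁻ (allowed interior l b) face′))
  by-label : ∀ l b → allowed interior l b ∧ isJoinFace rest (missedAfter missed l b) interior F ≡ true →
    ∣ b ∷ F ∣ ≤ facetSizeStep l (facetSize rest) missed
  by-label unused false face′ =
    joinFace-size≤facetSize rest missed interior F (rest-face unused false (missedAfter-unused missed false) face′)
  by-label apex b face′ = ℕP.≤-trans (∣∷∣≤ b F)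
    (s≤s (joinFace-size≤facetSize rest missed interior F (rest-face apex b (missedAfter-apex missed b) face′)))
  by-label (block β) b face′ with missed β in β-missed
  ... | true = ℕP.≤-trans (∣∷∣≤ b F)
    (s≤s (joinFace-size≤facetSize rest missed interior F (rest-face (block β) b (missedAfter-missed missed β b β-missed) face′)))
  by-label (block β) true face′ | false with markMissed-facetSize rest missed β β-missed
  ... | inj₁ β-empty =
    ⊥-elim (BP.not-¬ (rest-face (block β) true (missedAfter-true missed (block β)) face′)
                     (isJoinFace-blockless rest missed interior β β-missed β-empty F))
  ... | inj₂ grows = subst (suc ∣ F ∣ ≤_) (sym grows)
    (s≤s (joinFace-size≤facetSize rest missed interior F (rest-face (block β) true (missedAfter-true missed (block β)) face′)))
  by-label (block β) false face′ | false =
    joinFace-size≤facetSize rest (markMissed missed β) interior F (rest-face (block β) false (missedAfter-false missed β) face′)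

UnmissedNonempty : ∀ {n k} → (Fin n → Label k) → (Fin k → Bool) → Set
UnmissedNonempty lab missed = ∀ β → missed β ≡ false → 1 ≤ blockSize lab β

join-hasFaceOfFacetSize : ∀ {n k} (lab : Fin n → Label k) missed → UnmissedNonempty lab missed →
  ∃[ F ] (isJoinFace lab missed false F ≡ true × ∣ F ∣ ≡ facetSize lab missed)
join-hasFaceOfFacetSize {zero} lab missed nonempty = [] , allᶠ-intro all-missed , refl
  where
  all-missed : ∀ β → (missed β ∨ false) ≡ true
  all-missed β with missed β in β-missed
  ... | true = refl
  ... | false with nonempty β β-missed
  ...   | ()
join-hasFaceOfFacetSize {suc n} {k} lab missed nonempty with by-label (lab zero) nonempty
  where
  rest = lab ∘ suc
  other-blocks : ∀ β →
    (∀ γ → missed γ ≡ false → 1 ≤ bit (isBlock γ (block β)) ℕ.+ blockSize rest γ) →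
    ∀ γ → γ ≢ β → missed γ ≡ false → 1 ≤ blockSize rest γ
  other-blocks β nonempty′ γ γ≢β γ-fresh =
    subst (λ b → 1 ≤ bit b ℕ.+ blockSize rest γ) (isBlock-other γ β γ≢β) (nonempty′ γ γ-fresh)
  by-label : ∀ l → (∀ β → missed β ≡ false → 1 ≤ bit (isBlock β l) ℕ.+ blockSize rest β) →
    ∃[ b ] ∃[ F ] ((allowed false l b ∧ isJoinFace rest (missedAfter missed l b) false F ≡ true)
                   × ∣ b ∷ F ∣ ≡ facetSizeStep l (facetSize rest) missed)
  by-label unused nonempty′ with join-hasFaceOfFacetSize rest missed nonempty′
  ... | F , face , size = false , F , trans (isJoinFace-cong rest false (missedAfter-unused missed false) F) face , size
  by-label apex nonempty′ with join-hasFaceOfFacetSize rest missed nonempty′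
  ... | F , face , size = true , F , trans (isJoinFace-cong rest false (missedAfter-apex missed true) F) face , cong suc size
  by-label (block β) nonempty′ with missed β in β-missed
  ... | true with join-hasFaceOfFacetSize rest missed nonempty-rest
    where
    nonempty-rest : UnmissedNonempty rest missed
    nonempty-rest γ γ-fresh with γ FinP.≟ β
    ... | yes refl = contradiction (trans (sym β-missed) γ-fresh) λ ()
    ... | no γ≢β = other-blocks β nonempty′ γ γ≢β γ-fresh
  ...   | F , face , size = true , F , trans (isJoinFace-cong rest false (missedAfter-true missed (block β)) F) face , cong suc size
  by-label (block β) nonempty′ | false with blockSize rest β in β-size
  ... | zero with join-hasFaceOfFacetSize rest (markMissed missed β) nonempty-rest
    where
    nonempty-rest : UnmissedNonempty rest (markMissed missed β)
    nonempty-rest γ γ-fresh with γ FinP.≟ β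
    ... | yes refl = contradiction (trans (sym (BP.∨-zeroʳ (missed γ))) γ-fresh) λ ()
    ... | no γ≢β = other-blocks β nonempty′ γ γ≢β (trans (sym (BP.∨-identityʳ (missed γ))) γ-fresh)
  ...   | F , face , size = false , F , trans (isJoinFace-cong rest false (missedAfter-false missed β) F) face , size
  by-label (block β) nonempty′ | false | suc _ with join-hasFaceOfFacetSize rest missed nonempty-rest
                                                 | markMissed-facetSize rest missed β β-missed
    where
    nonempty-rest : UnmissedNonempty rest missed
    nonempty-rest γ γ-fresh with γ FinP.≟ β
    ... | yes refl rewrite β-size = s≤s z≤n
    ... | no γ≢β = other-blocks β nonempty′ γ γ≢β γ-fresh
  ... | _ | inj₁ β-empty = contradiction (trans (sym β-size) β-empty) λ ()
  ... | F , face , size | inj₂ grows =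
    true , F , trans (isJoinFace-cong rest false (missedAfter-true missed (block β)) F) face , trans (cong suc size) (sym grows)
... | b , F , face , size = b ∷ F , trans (isJoinFace-∷ lab missed false b F) face , size

-- The h-vector as a weighted face count

-- By the symmetry of binomial coefficients, h_i = Σ_F hWeight d i ∣F∣ (see hvec≡hSum).
hWeight : ℕ → ℕ → ℕ → ℤ
hWeight D i j = if j ℕ.≤ᵇ i then (-1ℤ ^ (i ℕ.∸ j)) * + ((D ℕ.∸ j) C (i ℕ.∸ j)) else 0ℤ

hSum : ∀ {n} → ℕ → ℕ → (Subset n → Bool) → ℤ
hSum {n} D i p = sumBy (λ F → if p F then hWeight D i ∣ F ∣ else 0ℤ) (allSubsets n)

hSum⁺ : ∀ {n} → ℕ → ℕ → (Subset n → Bool) → ℤ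
hSum⁺ {n} D i p = sumBy (λ F → if p F then hWeight D i (suc ∣ F ∣) else 0ℤ) (allSubsets n)

hSum-∷ : ∀ {n} D i (p : Subset (suc n) → Bool) →
  hSum D i p ≡ hSum⁺ D i (λ F → p (true ∷ F)) + hSum D i (λ F → p (false ∷ F))
hSum-∷ {n} D i p =
  trans (sumBy-++ _ (map (inside ∷_) (allSubsets n)) _)
    (cong₂ _+_ (sumBy-map _ (inside ∷_) (allSubsets n)) (sumBy-map _ (outside ∷_) (allSubsets n)))

hWeight-suc : ∀ D i j → hWeight D (suc i) (suc j) ≡ hWeight (D ℕ.∸ 1) i j
hWeight-suc D i j = cong₂ (λ b n → if b then (-1ℤ ^ (i ℕ.∸ j)) * + (n C (i ℕ.∸ j)) else 0ℤ)
  (≤ᵇ-suc j i) (sym (ℕP.∸-+-assoc D 1 j))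

hWeight-pascal-0 : ∀ D j → hWeight (suc D) 0 j ≡ hWeight D 0 j
hWeight-pascal-0 D zero = refl
hWeight-pascal-0 D (suc j) = refl

hWeight-pascal : ∀ D i j → j ≤ D → hWeight (suc D) (suc i) j ≡ hWeight D (suc i) j - hWeight D i j
hWeight-pascal D i j j≤D with j ℕ.≤ᵇ i in j≤ᵇi | j ℕ.≤ᵇ suc i in j≤ᵇ1+i
... | true | true =
  begin
    -1ℤ ^ (suc i ℕ.∸ j) * + ((suc D ℕ.∸ j) C (suc i ℕ.∸ j))
  ≡⟨ cong₂ (λ a N → -1ℤ ^ a * + (N C a)) (ℕP.+-∸-assoc 1 j≤i) (ℕP.+-∸-assoc 1 j≤D) ⟩
    -1ℤ ^ suc a * + (suc N C suc a)
  ≡⟨ cong (λ x → -1ℤ ^ suc a * + x) (sym (nCk+nC[k+1]≡[n+1]C[k+1] N a)) ⟩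
    -1ℤ * s * (+ (N C a) + + (N C suc a))
  ≡⟨ pascal s (+ (N C a)) (+ (N C suc a)) ⟩
    -1ℤ * s * + (N C suc a) - s * + (N C a)
  ≡⟨ cong (λ a′ → -1ℤ ^ a′ * + (N C a′) - s * + (N C a)) (sym (ℕP.+-∸-assoc 1 j≤i)) ⟩
    -1ℤ ^ (suc i ℕ.∸ j) * + ((D ℕ.∸ j) C (suc i ℕ.∸ j)) - s * + (N C a)
  ∎
  where
  open ≡-Reasoning
  j≤i = ≤ᵇ≡true⇒≤ {j} {i} j≤ᵇi
  a = i ℕ.∸ j
  N = D ℕ.∸ j
  s = -1ℤ ^ a
  pascal : ∀ s x y → -1ℤ * s * (x + y) ≡ -1ℤ * s * y - s * x
  pascal = solve-∀
... | true | false =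
  contradiction (ℕP.m≤n⇒m≤1+n (≤ᵇ≡true⇒≤ {j} {i} j≤ᵇi)) (ℕP.<⇒≱ (≤ᵇ≡false⇒> {j} {suc i} j≤ᵇ1+i))
... | false | false = refl
... | false | true rewrite ℕP.≤-antisym (≤ᵇ≡true⇒≤ {j} {suc i} j≤ᵇ1+i) (≤ᵇ≡false⇒> {j} {i} j≤ᵇi)
                        | ℕP.n∸n≡0 i = refl

hSum-cong : ∀ {n} D i {p q : Subset n → Bool} → (∀ F → p F ≡ q F) → hSum D i p ≡ hSum D i q
hSum-cong D i e = sumBy-cong (λ F → cong (λ z → if z then hWeight D i ∣ F ∣ else 0ℤ) (e F)) (allSubsets _)

hSum⁺-cong : ∀ {n} D i {p q : Subset n → Bool} → (∀ F → p F ≡ q F) → hSum⁺ D i p ≡ hSum⁺ D i q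
hSum⁺-cong D i e = sumBy-cong (λ F → cong (λ z → if z then hWeight D i (suc ∣ F ∣) else 0ℤ) (e F)) (allSubsets _)

hSum-empty : ∀ {n} D i {p : Subset n → Bool} → (∀ F → p F ≡ false) → hSum D i p ≡ 0ℤ
hSum-empty D i e = sumBy-zero (λ F → cong (λ z → if z then hWeight D i ∣ F ∣ else 0ℤ) (e F)) (allSubsets _)

hSum⁺-empty : ∀ {n} D i {p : Subset n → Bool} → (∀ F → p F ≡ false) → hSum⁺ D i p ≡ 0ℤ
hSum⁺-empty D i e = sumBy-zero (λ F → cong (λ z → if z then hWeight D i (suc ∣ F ∣) else 0ℤ) (e F)) (allSubsets _)

hSum⁺-0 : ∀ {n} D (p : Subset n → Bool) → hSum⁺ D 0 p ≡ 0ℤ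
hSum⁺-0 D p = sumBy-zero (λ F → if-same (p F)) (allSubsets _)
  where
  if-same : ∀ b → (if b then 0ℤ else 0ℤ) ≡ 0ℤ
  if-same true = refl
  if-same false = refl

hSum⁺-suc : ∀ {n} D i (p : Subset n → Bool) → hSum⁺ D (suc i) p ≡ hSum (D ℕ.∸ 1) i p
hSum⁺-suc D i p = sumBy-cong (λ F → cong (λ z → if p F then z else 0ℤ) (hWeight-suc D i ∣ F ∣)) (allSubsets _)

Bounded : ∀ {n} → ℕ → (Subset n → Bool) → Set
Bounded D p = ∀ F → p F ≡ true → ∣ F ∣ ≤ D

hSum-pascal : ∀ {n} D i (p : Subset n → Bool) → Bounded D p →
  hSum (suc D) (suc i) p ≡ hSum D (suc i) p - hSum D i p
hSum-pascal {n} D i p bounded =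
  trans (sumBy-cong pointwise (allSubsets n))
    (trans (sumBy-+ (w (suc i)) (λ F → - w i F) (allSubsets n)) (cong (_+_ (hSum D (suc i) p)) (sumBy-neg (w i) (allSubsets n))))
  where
  w : ℕ → Subset n → ℤ
  w i F = if p F then hWeight D i ∣ F ∣ else 0ℤ
  pointwise : ∀ F → (if p F then hWeight (suc D) (suc i) ∣ F ∣ else 0ℤ) ≡ w (suc i) F + - w i F
  pointwise F with p F in F∈p
  ... | true = hWeight-pascal D i ∣ F ∣ (bounded F F∈p)
  ... | false = refl

hSum-pascal-0 : ∀ {n} D (p : Subset n → Bool) → hSum (suc D) 0 p ≡ hSum D 0 p
hSum-pascal-0 D p = sumBy-cong (λ F → cong (λ z → if p F then z else 0ℤ) (hWeight-pascal-0 D ∣ F ∣)) (allSubsets _)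

-- The faces of a cone v * K are the faces F of K and F ∪ {v}: coning preserves the h-vector.
hSum-cone : ∀ {n} D i (p : Subset n → Bool) → Bounded D p → hSum⁺ (suc D) i p + hSum (suc D) i p ≡ hSum D i p
hSum-cone D zero p _ = trans (cong₂ _+_ (hSum⁺-0 (suc D) p) (hSum-pascal-0 D p)) (ℤP.+-identityˡ _)
hSum-cone D (suc i) p bounded =
  trans (cong₂ _+_ (hSum⁺-suc (suc D) i p) (hSum-pascal D i p bounded)) (cancel (hSum D i p) (hSum D (suc i) p))
  where
  cancel : ∀ a b → a + (b - a) ≡ b
  cancel = solve-∀

count-∷ : ∀ {A : Set} (p : A → Bool) x xs → + countᵇ p (x ∷ xs) ≡ + bit (p x) + + countᵇ p xs
count-∷ p x xs with p x
... | true = refl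
... | false = sym (ℤP.+-identityˡ _)

sumTo-cong : ∀ i {f g : ℕ → ℤ} → (∀ j → j ≤ i → f j ≡ g j) → sumTo i f ≡ sumTo i g
sumTo-cong zero e = e 0 z≤n
sumTo-cong (suc i) e = cong₂ _+_ (sumTo-cong i (λ j p → e j (ℕP.m≤n⇒m≤1+n p))) (e (suc i) ℕP.≤-refl)

sumTo-+ : ∀ i (f g : ℕ → ℤ) → sumTo i (λ j → f j + g j) ≡ sumTo i f + sumTo i g
sumTo-+ zero f g = refl
sumTo-+ (suc i) f g rewrite sumTo-+ i f g = interchange (sumTo i f) (sumTo i g) (f (suc i)) (g (suc i))

sumTo-zero : ∀ i {f : ℕ → ℤ} → (∀ j → f j ≡ 0ℤ) → sumTo i f ≡ 0ℤ
sumTo-zero zero e = e 0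
sumTo-zero (suc i) e rewrite sumTo-zero i e | e (suc i) = refl

sumTo-delta : ∀ i s (w : ℕ → ℤ) → sumTo i (λ j → w j * + bit (s ≡ᵇ j)) ≡ (if s ℕ.≤ᵇ i then w s else 0ℤ)
sumTo-delta zero zero w = ℤP.*-identityʳ (w 0)
sumTo-delta zero (suc s) w = ℤP.*-zeroʳ (w 0)
sumTo-delta (suc i) s w rewrite sumTo-delta i s w with ℕP.<-cmp s (suc i)
... | tri< s<1+i s≢1+i _
  rewrite ≤⇒≤ᵇ≡true {s} {i} (ℕP.≤-pred s<1+i) | ≤⇒≤ᵇ≡true {s} {suc i} (ℕP.<⇒≤ s<1+i) | ≡ᵇ-≢ s≢1+i =
  trans (cong (_+_ (w s)) (ℤP.*-zeroʳ (w (suc i)))) (ℤP.+-identityʳ (w s))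
... | tri≈ _ refl _ rewrite >⇒≤ᵇ≡false {suc i} {i} ℕP.≤-refl | ≤⇒≤ᵇ≡true {suc i} {suc i} ℕP.≤-refl | ≡ᵇ-refl i =
  trans (ℤP.+-identityˡ _) (ℤP.*-identityʳ _)
... | tri> _ s≢1+i 1+i<s
  rewrite >⇒≤ᵇ≡false {s} {i} (ℕP.<-trans ℕP.≤-refl 1+i<s) | >⇒≤ᵇ≡false {s} {suc i} 1+i<s | ≡ᵇ-≢ s≢1+i =
  trans (ℤP.+-identityˡ _) (ℤP.*-zeroʳ (w (suc i)))

sumTo-weightedCount : ∀ {A : Set} (p : A → Bool) (size : A → ℕ) i (w : ℕ → ℤ) xs →
  sumTo i (λ j → w j * + countᵇ (λ x → p x ∧ (size x ≡ᵇ j)) xs)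
    ≡ sumBy (λ x → if p x then (if size x ℕ.≤ᵇ i then w (size x) else 0ℤ) else 0ℤ) xs
sumTo-weightedCount p size i w [] = sumTo-zero i (λ j → ℤP.*-zeroʳ (w j))
sumTo-weightedCount p size i w (x ∷ xs) =
  trans (sumTo-cong i (λ j _ → trans (cong (w j *_) (count-∷ (λ y → p y ∧ (size y ≡ᵇ j)) x xs))
                                      (ℤP.*-distribˡ-+ (w j) _ _)))
    (trans (sumTo-+ i _ _) (cong₂ _+_ (head (p x) refl) (sumTo-weightedCount p size i w xs)))
  where
  head : ∀ b → p x ≡ b →
    sumTo i (λ j → w j * + bit (p x ∧ (size x ≡ᵇ j))) ≡ (if b then (if size x ℕ.≤ᵇ i then w (size x) else 0ℤ) else 0ℤ)
  head true e rewrite e = sumTo-delta i (size x) w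
  head false e rewrite e = sumTo-zero i (λ j → ℤP.*-zeroʳ (w j))

[d∸j]∸[i∸j]≡d∸i : ∀ {j i d} → j ≤ i → i ≤ d → (d ℕ.∸ j) ℕ.∸ (i ℕ.∸ j) ≡ d ℕ.∸ i
[d∸j]∸[i∸j]≡d∸i {j} j≤i i≤d with ℕP.m≤n⇒∃[o]m+o≡n j≤i | ℕP.m≤n⇒∃[o]m+o≡n i≤d
... | a , refl | b , refl =
  trans (cong₂ ℕ._∸_ (trans (cong (ℕ._∸ j) (ℕP.+-assoc j a b)) (ℕP.m+n∸m≡n j (a ℕ.+ b))) (ℕP.m+n∸m≡n j a))
    (trans (ℕP.m+n∸m≡n a b) (sym (ℕP.m+n∸m≡n (j ℕ.+ a) b)))

hvec≡hSum : ∀ {n} d (Δ : Complex n) i → i ≤ d → hvec d Δ i ≡ hSum d i Δ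
hvec≡hSum {n} d Δ i i≤d =
  trans (sumTo-cong i (λ j j≤i → trans (cong (λ m → (-1ℤ ^ (i ℕ.∸ j)) * (+ m * + fvec Δ j)) (binomial-symmetry j≤i))
                                        (sym (ℤP.*-assoc (-1ℤ ^ (i ℕ.∸ j)) _ _))))
    (trans (sumTo-weightedCount Δ ∣_∣ i (λ j → (-1ℤ ^ (i ℕ.∸ j)) * + ((d ℕ.∸ j) C (i ℕ.∸ j))) (allSubsets n))
      (sumBy-cong (λ F → if-weight {F} (Δ F)) (allSubsets n)))
  where
  binomial-symmetry : ∀ {j} → j ≤ i → (d ℕ.∸ j) C (d ℕ.∸ i) ≡ (d ℕ.∸ j) C (i ℕ.∸ j)
  binomial-symmetry {j} j≤i =
    sym (trans (nCk≡nC[n∸k] (ℕP.∸-monoˡ-≤ j i≤d)) (cong ((d ℕ.∸ j) C_) ([d∸j]∸[i∸j]≡d∸i j≤i i≤d)))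
  if-weight : ∀ {F : Subset n} b →
    (if b then (if ∣ F ∣ ℕ.≤ᵇ i then (-1ℤ ^ (i ℕ.∸ ∣ F ∣)) * + ((d ℕ.∸ ∣ F ∣) C (i ℕ.∸ ∣ F ∣)) else 0ℤ) else 0ℤ)
    ≡ (if b then hWeight d i ∣ F ∣ else 0ℤ)
  if-weight true = refl
  if-weight false = refl

-- The h-polynomial of a join

-- A missed block imposes no condition on its remaining vertices, so it acts as a full simplex,
-- whose h-polynomial is [1].
chainLengths : ∀ {n k} → (Fin n → Label k) → (Fin k → Bool) → Fin k → ℕ
chainLengths lab missed β = if missed β then 1 else blockSize lab β

apexShift : ∀ {n k} → Bool → (Fin n → Label k) → ℕ
apexShift interior lab = if interior then apexSize lab else 0

chainProductᶠ : ∀ {k} → (Fin k → ℕ) → Poly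
chainProductᶠ c = chainProduct (Vec.tabulate c)

joinPolynomial : ∀ {n k} → (Fin n → Label k) → (Fin k → Bool) → Bool → Poly
joinPolynomial lab missed interior j = chainProductᶠ (chainLengths lab missed) (j - + apexShift interior lab)

chainProductᶠ-cong : ∀ {k} {c c′ : Fin k → ℕ} → (∀ β → c β ≡ c′ β) → ∀ j → chainProductᶠ c j ≡ chainProductᶠ c′ j
chainProductᶠ-cong {zero} _ j = refl
chainProductᶠ-cong {suc k} {c} {c′} c≡c′ j =
  trans (cong (λ a → mulChain a (chainProductᶠ (c ∘ suc)) j) (c≡c′ zero))
    (mulChain-cong (c′ zero) (chainProductᶠ-cong (c≡c′ ∘ suc)) j)

chainProductᶠ-zero : ∀ {k} (c : Fin k → ℕ) β → c β ≡ 0 → ∀ j → chainProductᶠ c j ≡ 0ℤ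
chainProductᶠ-zero c zero c₀≡0 j = cong (λ a → mulChain a (chainProductᶠ (c ∘ suc)) j) c₀≡0
chainProductᶠ-zero c (suc β) cβ≡0 j = mulChain-zero (c zero) (chainProductᶠ-zero (c ∘ suc) β cβ≡0) j

chainProductᶠ-ones : ∀ {k} (c : Fin k → ℕ) → (∀ β → c β ≡ 1) → ∀ j → chainProductᶠ c j ≡ 1ₚ j
chainProductᶠ-ones {zero} c _ j = refl
chainProductᶠ-ones {suc k} c c≡1 j =
  trans (cong (λ a → mulChain a (chainProductᶠ (c ∘ suc)) j) (c≡1 zero))
    (trans (mulChain-1 (chainProductᶠ (c ∘ suc)) j) (chainProductᶠ-ones (c ∘ suc) (c≡1 ∘ suc) j))

chainProductᶠ-supported : ∀ {k} (c : Fin k → ℕ) → SupportedOnℕ (chainProductᶠ c)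
chainProductᶠ-supported c = chainProduct-supported (Vec.tabulate c)

-- In the β-th factor, [a + 1] = t · [a] + [1].
chainProductᶠ-split : ∀ {k} (c c′ c″ : Fin k → ℕ) β → c β ≡ suc (c′ β) → c″ β ≡ 1 →
  (∀ γ → γ ≢ β → c γ ≡ c′ γ) → (∀ γ → γ ≢ β → c γ ≡ c″ γ) →
  ∀ j → chainProductᶠ c j ≡ chainProductᶠ c′ (j - 1ℤ) + chainProductᶠ c″ j
chainProductᶠ-split c c′ c″ zero cβ≡ c″β≡1 c≡c′ c≡c″ j =
  begin
    mulChain (c zero) f j
  ≡⟨ cong (λ z → mulChain z f j) cβ≡ ⟩
    f j + mulChain (c′ zero) f (j - 1ℤ)
  ≡⟨ ℤP.+-comm (f j) _ ⟩
    mulChain (c′ zero) f (j - 1ℤ) + f j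
  ≡⟨ cong₂ _+_ (mulChain-cong (c′ zero) (chainProductᶠ-cong (λ γ → c≡c′ (suc γ) (λ ()))) (j - 1ℤ))
               (sym (trans (cong (λ z → mulChain z (chainProductᶠ (c″ ∘ suc)) j) c″β≡1)
                   (trans (mulChain-1 (chainProductᶠ (c″ ∘ suc)) j) (chainProductᶠ-cong (λ γ → sym (c≡c″ (suc γ) (λ ()))) j)))) ⟩
    chainProductᶠ c′ (j - 1ℤ) + chainProductᶠ c″ j
  ∎
  where
  open ≡-Reasoning
  f = chainProductᶠ (c ∘ suc)
chainProductᶠ-split c c′ c″ (suc β) cβ≡ c″β≡1 c≡c′ c≡c″ j =
  begin
    mulChain (c zero) (chainProductᶠ (c ∘ suc)) j
  ≡⟨ mulChain-cong (c zero) (chainProductᶠ-split (c ∘ suc) (c′ ∘ suc) (c″ ∘ suc) β cβ≡ c″β≡1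
        (λ γ γ≢β → c≡c′ (suc γ) (γ≢β ∘ FinP.suc-injective))
        (λ γ γ≢β → c≡c″ (suc γ) (γ≢β ∘ FinP.suc-injective))) j ⟩
    mulChain (c zero) (λ i → chainProductᶠ (c′ ∘ suc) (i - 1ℤ) + chainProductᶠ (c″ ∘ suc) i) j
  ≡⟨ mulChain-+ (c zero) _ _ j ⟩
    mulChain (c zero) (λ i → chainProductᶠ (c′ ∘ suc) (i - 1ℤ)) j + mulChain (c zero) (chainProductᶠ (c″ ∘ suc)) j
  ≡⟨ cong₂ _+_ (trans (mulChain-shift (c zero) (chainProductᶠ (c′ ∘ suc)) j)
                      (cong (λ a → mulChain a (chainProductᶠ (c′ ∘ suc)) (j - 1ℤ)) (c≡c′ zero (λ ()))))
               (cong (λ z → mulChain z (chainProductᶠ (c″ ∘ suc)) j) (c≡c″ zero (λ ()))) ⟩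
    chainProductᶠ c′ (j - 1ℤ) + chainProductᶠ c″ j
  ∎
  where
  open ≡-Reasoning

hWeight-0-0 : ∀ i → hWeight 0 i 0 + 0ℤ ≡ 1ₚ (+ i)
hWeight-0-0 zero = refl
hWeight-0-0 (suc i) = trans (ℤP.+-identityʳ _) (ℤP.*-zeroʳ (-1ℤ ^ suc i))

module JoinStep {n k} (rest : Fin n → Label k)
  (ih : ∀ missed interior i → hSum (facetSize rest missed) i (isJoinFace rest missed interior)
                              ≡ joinPolynomial rest missed interior (+ i)) where

  Step : Label k → (Fin k → Bool) → Bool → ℕ → Set
  Step l missed interior i =
    hSum⁺ D i (λ F → allowed interior l true ∧ isJoinFace rest (missedAfter missed l true) interior F)
    + hSum D i (λ F → allowed interior l false ∧ isJoinFace rest (missedAfter missed l false) interior F)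
    ≡ chainProductᶠ (λ β → if missed β then 1 else bit (isBlock β l) ℕ.+ blockSize rest β)
        (+ i - + (if interior then bit (isApex l) ℕ.+ apexSize rest else 0))
    where
    D = facetSizeStep l (facetSize rest) missed

  D = facetSize rest

  viaCone : ∀ missed interior i {p q : Subset n → Bool} →
    (∀ F → p F ≡ isJoinFace rest missed interior F) → (∀ F → q F ≡ isJoinFace rest missed interior F) →
    hSum⁺ (suc (D missed)) i p + hSum (suc (D missed)) i q ≡ joinPolynomial rest missed interior (+ i)
  viaCone missed interior i p≡ q≡ =
    trans (cong₂ _+_ (hSum⁺-cong (suc (D missed)) i p≡) (hSum-cong (suc (D missed)) i q≡))
      (trans (hSum-cone (D missed) i (isJoinFace rest missed interior) (joinFace-size≤facetSize rest missed interior))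
        (ih missed interior i))

  step-unused : ∀ missed interior i → Step unused missed interior i
  step-unused missed interior i =
    trans (cong₂ _+_ (hSum⁺-empty (D missed) i {λ F → false ∧ isJoinFace rest (missedAfter missed unused true) interior F}
                        (λ F → refl))
                     (hSum-cong (D missed) i (isJoinFace-cong rest interior (missedAfter-unused missed false))))
      (trans (ℤP.+-identityˡ _) (ih missed interior i))

  step-apex : ∀ missed interior i → Step apex missed interior i
  step-apex missed false i =
    viaCone missed false i (isJoinFace-cong rest false (missedAfter-apex missed true))
      (isJoinFace-cong rest false (missedAfter-apex missed false))
  step-apex missed true zero =
    trans (cong₂ _+_ (hSum⁺-0 (suc (D missed)) (isJoinFace rest (missedAfter missed apex true) true))
                     (hSum-empty (suc (D missed)) 0 {λ F → false ∧ isJoinFace rest (missedAfter missed apex false) true F}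
                        (λ F → refl)))
      (sym (trans (cong (chainProductᶠ (chainLengths rest missed)) (0-[1+a]≡-[1+a] (+ apexSize rest)))
             (chainProductᶠ-supported (chainLengths rest missed) (apexSize rest))))
    where
    0-[1+a]≡-[1+a] : ∀ a → 0ℤ - (1ℤ + a) ≡ - (1ℤ + a)
    0-[1+a]≡-[1+a] = solve-∀
  step-apex missed true (suc i) =
    trans (cong₂ _+_ (hSum⁺-suc (suc (D missed)) i (isJoinFace rest (missedAfter missed apex true) true))
                     (hSum-empty (suc (D missed)) (suc i) {λ F → false ∧ isJoinFace rest (missedAfter missed apex false) true F}
                        (λ F → refl)))
      (trans (ℤP.+-identityʳ _)
      (trans (hSum-cong (D missed) i (isJoinFace-cong rest true (missedAfter-apex missed true)))
      (trans (ih missed true i)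
      (cong (chainProductᶠ (chainLengths rest missed)) (sym (1+i-[1+a]≡i-a (+ i) (+ apexSize rest)))))))
    where
    1+i-[1+a]≡i-a : ∀ i a → 1ℤ + i - (1ℤ + a) ≡ i - a
    1+i-[1+a]≡i-a = solve-∀

  step-missedBlock : ∀ missed interior i β → missed β ≡ true → Step (block β) missed interior i
  step-missedBlock missed interior i β β-missed rewrite β-missed =
    trans (viaCone missed interior i (isJoinFace-cong rest interior (missedAfter-missed missed β true β-missed))
                                     (isJoinFace-cong rest interior (missedAfter-missed missed β false β-missed)))
      (chainProductᶠ-cong same-lengths _)
    where
    same-lengths : ∀ γ → chainLengths rest missed γ ≡ (if missed γ then 1 else bit (isBlock γ (block β)) ℕ.+ blockSize rest γ)
    same-lengths γ with missed γ in γ-missed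
    ... | true = refl
    ... | false with γ FinP.≟ β
    ...   | yes refl = contradiction (trans (sym β-missed) γ-missed) λ ()
    ...   | no γ≢β = refl

  faces-through-freshBlock : ∀ missed interior i β → missed β ≡ false →
    hSum⁺ (D (markMissed missed β)) i (isJoinFace rest missed interior)
    ≡ chainProductᶠ (chainLengths rest missed) (+ i - + apexShift interior rest - 1ℤ)
  faces-through-freshBlock missed interior zero β β-fresh =
    trans (hSum⁺-0 (D (markMissed missed β)) (isJoinFace rest missed interior))
      (sym (trans (cong (chainProductᶠ (chainLengths rest missed)) (0-s-1≡-[1+s] (+ apexShift interior rest)))
             (chainProductᶠ-supported (chainLengths rest missed) (apexShift interior rest))))
    where
    0-s-1≡-[1+s] : ∀ s → 0ℤ - s - 1ℤ ≡ - (1ℤ + s)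
    0-s-1≡-[1+s] = solve-∀
  faces-through-freshBlock missed interior (suc i) β β-fresh
    with markMissed-facetSize rest missed β β-fresh
  ... | inj₁ β-empty =
    trans (hSum⁺-suc (D (markMissed missed β)) i (isJoinFace rest missed interior))
      (trans (hSum-empty (D (markMissed missed β) ℕ.∸ 1) i (isJoinFace-blockless rest missed interior β β-fresh β-empty))
        (sym (chainProductᶠ-zero (chainLengths rest missed) β
               (trans (cong (λ b → if b then 1 else blockSize rest β) β-fresh) β-empty) _)))
  ... | inj₂ D-grows =
    trans (hSum⁺-suc (D (markMissed missed β)) i (isJoinFace rest missed interior))
      (trans (cong (λ m → hSum (m ℕ.∸ 1) i (isJoinFace rest missed interior)) D-grows)
        (trans (ih missed interior i)
          (cong (chainProductᶠ (chainLengths rest missed)) (sym (1+i-s-1≡i-s (+ i) (+ apexShift interior rest))))))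
    where
    1+i-s-1≡i-s : ∀ i s → 1ℤ + i - s - 1ℤ ≡ i - s
    1+i-s-1≡i-s = solve-∀

  step-freshBlock : ∀ missed interior i β → missed β ≡ false → Step (block β) missed interior i
  step-freshBlock missed interior i β β-fresh rewrite β-fresh =
    trans (cong₂ _+_ (hSum⁺-cong (D (markMissed missed β)) i (isJoinFace-cong rest interior (missedAfter-true missed (block β))))
                     (hSum-cong (D (markMissed missed β)) i (isJoinFace-cong rest interior (missedAfter-false missed β))))
      (trans (cong₂ _+_ (faces-through-freshBlock missed interior i β β-fresh) (ih (markMissed missed β) interior i))
        (sym (chainProductᶠ-split c (chainLengths rest missed) (chainLengths rest (markMissed missed β)) β c-β c″-β c≡c′ c≡c″
               (+ i - + apexShift interior rest))))
    where
    c : Fin k → ℕ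
    c γ = if missed γ then 1 else bit (isBlock γ (block β)) ℕ.+ blockSize rest γ
    c-β : c β ≡ suc (chainLengths rest missed β)
    c-β rewrite β-fresh | isBlock-self β = refl
    c″-β : chainLengths rest (markMissed missed β) β ≡ 1
    c″-β rewrite isBlock-self β | BP.∨-zeroʳ (missed β) = refl
    c≡c′ : ∀ γ → γ ≢ β → c γ ≡ chainLengths rest missed γ
    c≡c′ γ γ≢β rewrite isBlock-other γ β γ≢β = refl
    c≡c″ : ∀ γ → γ ≢ β → c γ ≡ chainLengths rest (markMissed missed β) γ
    c≡c″ γ γ≢β rewrite isBlock-other γ β γ≢β | BP.∨-identityʳ (missed γ) = refl

  step : ∀ l missed interior i → Step l missed interior i
  step unused = step-unused
  step apex = step-apex
  step (block β) missed interior i = byMissed (missed β) refl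
    where
    byMissed : ∀ b → missed β ≡ b → Step (block β) missed interior i
    byMissed true β-missed = step-missedBlock missed interior i β β-missed
    byMissed false β-fresh = step-freshBlock missed interior i β β-fresh

-- Induction over the vertices: an apex vertex cones off the rest of the join, and a vertex of a block
-- β not yet missed either lies in the face or makes β missed (chainProductᶠ-split).
hSum-join : ∀ {n k} (lab : Fin n → Label k) missed interior i →
  hSum (facetSize lab missed) i (isJoinFace lab missed interior) ≡ joinPolynomial lab missed interior (+ i)
hSum-join {zero} lab missed interior i with allᶠ (λ β → missed β ∨ false) in all-missed
... | true = trans (hWeight-0-0 i) (sym (trans (chainProductᶠ-ones _ ones _) (cong 1ₚ (i-0≡i interior))))
  where
  ones : ∀ β → chainLengths lab missed β ≡ 1
  ones β rewrite trans (sym (BP.∨-identityʳ (missed β))) (allᶠ-elim {p = λ β → missed β ∨ false} all-missed β) = refl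
  i-0≡i : ∀ interior → + i - + (if interior then 0 else 0) ≡ + i
  i-0≡i true = ℤP.+-identityʳ (+ i)
  i-0≡i false = ℤP.+-identityʳ (+ i)
... | false with allᶠ-false-elim all-missed
...   | β , β-fresh = sym (chainProductᶠ-zero _ β empty-chain _)
  where
  empty-chain : chainLengths lab missed β ≡ 0
  empty-chain rewrite trans (sym (BP.∨-identityʳ (missed β))) β-fresh = refl
hSum-join {suc n} lab missed interior i =
  trans (hSum-∷ (facetSize lab missed) i (isJoinFace lab missed interior))
    (trans (cong₂ _+_ (hSum⁺-cong (facetSize lab missed) i (isJoinFace-∷ lab missed interior true))
                      (hSum-cong (facetSize lab missed) i (isJoinFace-∷ lab missed interior false)))
      (JoinStep.step (lab ∘ suc) (hSum-join (lab ∘ suc)) (lab zero) missed interior i))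

∣insert∣ : ∀ {n} (F : Vec Bool n) x → lookup F x ≡ false → ∣ F [ x ]≔ true ∣ ≡ suc ∣ F ∣
∣insert∣ (false ∷ F) zero _ = refl
∣insert∣ (true ∷ F) (suc x) x∉F = cong suc (∣insert∣ F x x∉F)
∣insert∣ (false ∷ F) (suc x) x∉F = ∣insert∣ F x x∉F

∣delete∣ : ∀ {n} (F : Vec Bool n) x → lookup F x ≡ true → suc ∣ F [ x ]≔ false ∣ ≡ ∣ F ∣
∣delete∣ (true ∷ F) zero _ = refl
∣delete∣ (true ∷ F) (suc x) x∈F = cong suc (∣delete∣ F x x∈F)
∣delete∣ (false ∷ F) (suc x) x∈F = ∣delete∣ F x x∈F

∣∣-pos : ∀ {n} (F : Vec Bool n) x → lookup F x ≡ true → 1 ≤ ∣ F ∣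
∣∣-pos (true ∷ F) zero _ = s≤s z≤n
∣∣-pos (true ∷ F) (suc x) _ = s≤s z≤n
∣∣-pos (false ∷ F) (suc x) x∈F = ∣∣-pos F x x∈F

infix 4 _⊆ₗ_

_⊆ₗ_ : ∀ {n} → Vec Bool n → Vec Bool n → Set
G ⊆ₗ H = ∀ x → lookup G x ≡ true → lookup H x ≡ true

⊆⇒⊆ₗ : ∀ {n} {G H : Subset n} → G ⊆ H → G ⊆ₗ H
⊆⇒⊆ₗ {G = G} {H} s x e = VP.[]=⇒lookup (s (VP.lookup⇒[]= x G e))

⊆ₗ⇒⊆ : ∀ {n} {G H : Subset n} → G ⊆ₗ H → G ⊆ H
⊆ₗ⇒⊆ {G = G} {H} s {x} m = VP.lookup⇒[]= x H (s x (VP.[]=⇒lookup m))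

⊆ₗ-tail : ∀ {n} {a b} {G H : Vec Bool n} → (a ∷ G) ⊆ₗ (b ∷ H) → G ⊆ₗ H
⊆ₗ-tail s x e = s (suc x) e

⊆ᵇ-sound : ∀ {n} (G H : Vec Bool n) → (G ⊆ᵇ H) ≡ true → G ⊆ₗ H
⊆ᵇ-sound (a ∷ G) (b ∷ H) e with ∧≡true⁻ (not a ∨ b) e
⊆ᵇ-sound (true ∷ G) (true ∷ H) e | p , q = λ { zero _ → refl ; (suc x) m → ⊆ᵇ-sound G H q x m }
⊆ᵇ-sound (false ∷ G) (b ∷ H) e | p , q = λ { zero () ; (suc x) m → ⊆ᵇ-sound G H q x m }

⊆ᵇ-complete : ∀ {n} (G H : Vec Bool n) → G ⊆ₗ H → (G ⊆ᵇ H) ≡ true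
⊆ᵇ-complete [] [] s = refl
⊆ᵇ-complete (true ∷ G) (true ∷ H) s = ⊆ᵇ-complete G H (⊆ₗ-tail s)
⊆ᵇ-complete (true ∷ G) (false ∷ H) s with s zero refl
... | ()
⊆ᵇ-complete (false ∷ G) (b ∷ H) s rewrite BP.∨-zeroˡ b = ⊆ᵇ-complete G H (⊆ₗ-tail s)

⊆ₗ⇒∣∣≤ : ∀ {n} (G H : Vec Bool n) → G ⊆ₗ H → ∣ G ∣ ≤ ∣ H ∣
⊆ₗ⇒∣∣≤ [] [] s = z≤n
⊆ₗ⇒∣∣≤ (true ∷ G) (true ∷ H) s = s≤s (⊆ₗ⇒∣∣≤ G H (⊆ₗ-tail s))
⊆ₗ⇒∣∣≤ (true ∷ G) (false ∷ H) s with s zero refl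
... | ()
⊆ₗ⇒∣∣≤ (false ∷ G) (true ∷ H) s = ℕP.m≤n⇒m≤1+n (⊆ₗ⇒∣∣≤ G H (⊆ₗ-tail s))
⊆ₗ⇒∣∣≤ (false ∷ G) (false ∷ H) s = ⊆ₗ⇒∣∣≤ G H (⊆ₗ-tail s)

⊆ₗ∧∣∣≡⇒≡ : ∀ {n} (G H : Vec Bool n) → G ⊆ₗ H → ∣ G ∣ ≡ ∣ H ∣ → G ≡ H
⊆ₗ∧∣∣≡⇒≡ [] [] s e = refl
⊆ₗ∧∣∣≡⇒≡ (true ∷ G) (true ∷ H) s e = cong (true ∷_) (⊆ₗ∧∣∣≡⇒≡ G H (⊆ₗ-tail s) (ℕP.suc-injective e))
⊆ₗ∧∣∣≡⇒≡ (true ∷ G) (false ∷ H) s e with s zero refl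
... | ()
⊆ₗ∧∣∣≡⇒≡ (false ∷ G) (true ∷ H) s e = ⊥-elim (ℕP.<-irrefl e (s≤s (⊆ₗ⇒∣∣≤ G H (⊆ₗ-tail s))))
⊆ₗ∧∣∣≡⇒≡ (false ∷ G) (false ∷ H) s e = cong (false ∷_) (⊆ₗ∧∣∣≡⇒≡ G H (⊆ₗ-tail s) e)

⊆ₗ∧∣∣<⇒∃ : ∀ {n} (G H : Vec Bool n) → G ⊆ₗ H → ∣ G ∣ < ∣ H ∣ →
  ∃[ y ] (lookup H y ≡ true × lookup G y ≡ false)
⊆ₗ∧∣∣<⇒∃ (true ∷ G) (true ∷ H) s (s≤s p) with ⊆ₗ∧∣∣<⇒∃ G H (⊆ₗ-tail s) p
... | y , a , b = suc y , a , b
⊆ₗ∧∣∣<⇒∃ (true ∷ G) (false ∷ H) s p with s zero refl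
... | ()
⊆ₗ∧∣∣<⇒∃ (false ∷ G) (true ∷ H) s p = zero , refl , refl
⊆ₗ∧∣∣<⇒∃ (false ∷ G) (false ∷ H) s p with ⊆ₗ∧∣∣<⇒∃ G H (⊆ₗ-tail s) p
... | y , a , b = suc y , a , b

⊆ₗ-insert : ∀ {n} (G : Subset n) x → G ⊆ₗ G [ x ]≔ true
⊆ₗ-insert G x y y∈G with x FinP.≟ y
... | yes refl = VP.lookup∘update x G true
... | no x≢y = trans (VP.lookup∘update′ (≢-sym x≢y) G true) y∈G

⊆ₗ-delete : ∀ {n} (F H : Subset n) x → F ⊆ₗ H → lookup F x ≡ false → F ⊆ₗ H [ x ]≔ false
⊆ₗ-delete F H x F⊆H x∉F y y∈F with x FinP.≟ y
... | yes refl = contradiction (trans (sym y∈F) x∉F) λ ()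
... | no x≢y = trans (VP.lookup∘update′ (≢-sym x≢y) H false) (F⊆H y y∈F)

delete-⊆ₗ : ∀ {n} (H : Subset n) x → H [ x ]≔ false ⊆ₗ H
delete-⊆ₗ H x y y∈H-x with x FinP.≟ y
... | yes refl = contradiction (trans (sym y∈H-x) (VP.lookup∘update x H false)) λ ()
... | no x≢y = trans (sym (VP.lookup∘update′ (≢-sym x≢y) H false)) y∈H-x

count-allSubsets : ∀ {n} (p : Subset (suc n) → Bool) →
  countᵇ p (allSubsets (suc n)) ≡ countᵇ (p ∘ (true ∷_)) (allSubsets n) ℕ.+ countᵇ (p ∘ (false ∷_)) (allSubsets n)
count-allSubsets {n} p = trans (count-++ p (map (inside ∷_) (allSubsets n)) _)
  (cong₂ ℕ._+_ (count-map p (inside ∷_) (allSubsets n)) (count-map p (outside ∷_) (allSubsets n)))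

count-pos : ∀ {n} (p : Subset n → Bool) H → p H ≡ true → 1 ≤ countᵇ p (allSubsets n)
count-pos {zero} p [] e rewrite e = s≤s z≤n
count-pos {suc n} p (true ∷ H) e rewrite count-allSubsets p = ℕP.≤-trans (count-pos (p ∘ (true ∷_)) H e) (ℕP.m≤m+n _ _)
count-pos {suc n} p (false ∷ H) e rewrite count-allSubsets p = ℕP.≤-trans (count-pos (p ∘ (false ∷_)) H e) (ℕP.m≤n+m _ _)

count-unique : ∀ {n} (p : Subset n → Bool) H → p H ≡ true → (∀ H′ → p H′ ≡ true → H′ ≡ H) →
  countᵇ p (allSubsets n) ≡ 1
count-unique {zero} p [] H∈p _ rewrite H∈p = refl
count-unique {suc n} p (true ∷ H) H∈p unique rewrite count-allSubsets p =
  cong₂ ℕ._+_ (count-unique (p ∘ (true ∷_)) H H∈p (λ H′ H′∈p → VP.∷-injectiveʳ (unique _ H′∈p)))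
    (count-none {p = p ∘ (false ∷_)} (λ H′ → BP.¬-not (λ H′∈p → contradiction (unique _ H′∈p) λ ())) (allSubsets n))
count-unique {suc n} p (false ∷ H) H∈p unique rewrite count-allSubsets p =
  cong₂ ℕ._+_ (count-none {p = p ∘ (true ∷_)} (λ H′ → BP.¬-not (λ H′∈p → contradiction (unique _ H′∈p) λ ())) (allSubsets n))
    (count-unique (p ∘ (false ∷_)) H H∈p (λ H′ H′∈p → VP.∷-injectiveʳ (unique _ H′∈p)))

count-two : ∀ {n} (p : Subset n → Bool) H₁ H₂ → p H₁ ≡ true → p H₂ ≡ true → H₁ ≢ H₂ →
  2 ≤ countᵇ p (allSubsets n)
count-two {zero} p [] [] H₁∈p H₂∈p H₁≢H₂ = ⊥-elim (H₁≢H₂ refl)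
count-two {suc n} p (true ∷ H₁) (true ∷ H₂) H₁∈p H₂∈p H₁≢H₂ rewrite count-allSubsets p =
  ℕP.≤-trans (count-two (p ∘ (true ∷_)) H₁ H₂ H₁∈p H₂∈p (H₁≢H₂ ∘ cong (true ∷_))) (ℕP.m≤m+n _ _)
count-two {suc n} p (false ∷ H₁) (false ∷ H₂) H₁∈p H₂∈p H₁≢H₂ rewrite count-allSubsets p =
  ℕP.≤-trans (count-two (p ∘ (false ∷_)) H₁ H₂ H₁∈p H₂∈p (H₁≢H₂ ∘ cong (false ∷_))) (ℕP.m≤n+m _ _)
count-two {suc n} p (true ∷ H₁) (false ∷ H₂) H₁∈p H₂∈p H₁≢H₂ rewrite count-allSubsets p =
  ℕP.+-mono-≤ (count-pos (p ∘ (true ∷_)) H₁ H₁∈p) (count-pos (p ∘ (false ∷_)) H₂ H₂∈p)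
count-two {suc n} p (false ∷ H₁) (true ∷ H₂) H₁∈p H₂∈p H₁≢H₂ rewrite count-allSubsets p =
  ℕP.+-mono-≤ (count-pos (p ∘ (true ∷_)) H₂ H₂∈p) (count-pos (p ∘ (false ∷_)) H₁ H₁∈p)

module _ {n k : ℕ} (lb : Fin n → Label k) where

  record Face (F : Subset n) : Set where
    constructor mkFace
    field isFace : isJoinFace lb noneMissed false F ≡ true

  face-unused : ∀ {F} → Face F → ∀ x → lb x ≡ unused → lookup F x ≡ false
  face-unused {F} (mkFace face) x x-unused with ∧≡true⁻ (allᶠ (λ x → allowed false (lb x) (lookup F x))) face
  ... | vertices-allowed , _ with allᶠ-elim vertices-allowed x
  ... | q rewrite x-unused = not≡true⇒≡false q

  face-missesBlock : ∀ {F} → Face F → ∀ β → ∃[ z ] (lb z ≡ block β × lookup F z ≡ false)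
  face-missesBlock {F} (mkFace face) β with ∧≡true⁻ (allᶠ (λ x → allowed false (lb x) (lookup F x))) face
  ... | _ , blocks-missed with anyᶠ-elim (allᶠ-elim blocks-missed β)
  ...   | z , q with ∧≡true⁻ (isBlock β (lb z)) q
  ...     | z∈β , z∉F = z , isBlock-true β (lb z) z∈β , not≡true⇒≡false z∉F

  face-intro : ∀ F → (∀ x → lb x ≡ unused → lookup F x ≡ false) →
    (∀ β → ∃[ z ] (lb z ≡ block β × lookup F z ≡ false)) → Face F
  face-intro F no-unused misses = mkFace (∧≡true⁺ (allᶠ-intro vertices-allowed) (allᶠ-intro blocks-missed))
    where
    vertices-allowed : ∀ x → allowed false (lb x) (lookup F x) ≡ true
    vertices-allowed x with lb x in e
    ... | unused rewrite no-unused x e = refl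
    ... | apex = refl
    ... | block _ = refl
    blocks-missed : ∀ β → (false ∨ anyᶠ (λ x → isBlock β (lb x) ∧ not (lookup F x))) ≡ true
    blocks-missed β with misses β
    ... | z , z∈β , z∉F = anyᶠ-intro {p = λ x → isBlock β (lb x) ∧ not (lookup F x)} z
                            (cong₂ _∧_ (trans (cong (isBlock β) z∈β) (isBlock-self β)) (cong not z∉F))

  face-downward : ∀ {G H} → Face H → G ⊆ₗ H → Face G
  face-downward {G} {H} face G⊆H = face-intro G (λ x u → outside-H (face-unused face x u)) misses
    where
    outside-H : ∀ {x} → lookup H x ≡ false → lookup G x ≡ false
    outside-H x∉H = BP.¬-not (λ x∈G → BP.not-¬ (G⊆H _ x∈G) x∉H)
    misses : ∀ β → ∃[ z ] (lb z ≡ block β × lookup G z ≡ false)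
    misses β with face-missesBlock face β
    ... | z , z∈β , z∉H = z , z∈β , outside-H z∉H

  face-insert : ∀ {F x} → Face F → lb x ≢ unused →
    (∀ β → ∃[ z ] (lb z ≡ block β × z ≢ x × lookup F z ≡ false)) → Face (F [ x ]≔ true)
  face-insert {F} {x} face x-used misses = face-intro (F [ x ]≔ true) no-unused misses′
    where
    no-unused : ∀ y → lb y ≡ unused → lookup (F [ x ]≔ true) y ≡ false
    no-unused y y-unused =
      trans (VP.lookup∘update′ (λ y≡x → x-used (trans (cong lb (sym y≡x)) y-unused)) F true) (face-unused face y y-unused)
    misses′ : ∀ β → ∃[ z ] (lb z ≡ block β × lookup (F [ x ]≔ true) z ≡ false)
    misses′ β with misses β
    ... | z , z∈β , z≢x , z∉F = z , z∈β , trans (VP.lookup∘update′ z≢x F true) z∉F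

  face-missesBlock-elsewhere : ∀ {F} → Face F → ∀ {x} β → lb x ≢ block β →
    ∃[ z ] (lb z ≡ block β × z ≢ x × lookup F z ≡ false)
  face-missesBlock-elsewhere face β x∉β with face-missesBlock face β
  ... | z , z∈β , z∉F = z , z∈β , (λ z≡x → x∉β (trans (cong lb (sym z≡x)) z∈β)) , z∉F

  face-insertApex : ∀ {F} → Face F → ∀ x → lb x ≡ apex → Face (F [ x ]≔ true)
  face-insertApex face x x-apex =
    face-insert face (λ x-unused → contradiction (trans (sym x-unused) x-apex) λ ())
      (λ β → face-missesBlock-elsewhere face β (λ x∈β → contradiction (trans (sym x-apex) x∈β) λ ()))

  record InteriorFace (F : Subset n) : Set where
    constructor mkInteriorFace
    field isInteriorFace : isJoinFace lb noneMissed true F ≡ true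

  interior⇒face : ∀ {F} → InteriorFace F → Face F
  interior⇒face {F} (mkInteriorFace interior) with ∧≡true⁻ (allᶠ (λ x → allowed true (lb x) (lookup F x))) interior
  ... | vertices-allowed , blocks-missed = mkFace (∧≡true⁺ (allᶠ-intro allowed-exterior) blocks-missed)
    where
    allowed-exterior : ∀ x → allowed false (lb x) (lookup F x) ≡ true
    allowed-exterior x with lb x | allᶠ-elim vertices-allowed x
    ... | unused | q = q
    ... | apex | _ = refl
    ... | block _ | _ = refl

  interior-apex : ∀ {F} → InteriorFace F → ∀ x → lb x ≡ apex → lookup F x ≡ true
  interior-apex {F} (mkInteriorFace interior) x x-apex with ∧≡true⁻ (allᶠ (λ x → allowed true (lb x) (lookup F x))) interior
  ... | vertices-allowed , _ with allᶠ-elim vertices-allowed x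
  ...   | q rewrite x-apex = q

  interior-intro : ∀ {F} → Face F → (∀ x → lb x ≡ apex → lookup F x ≡ true) → InteriorFace F
  interior-intro {F} (mkFace face) apex⊆F with ∧≡true⁻ (allᶠ (λ x → allowed false (lb x) (lookup F x))) face
  ... | vertices-allowed , blocks-missed = mkInteriorFace (∧≡true⁺ (allᶠ-intro allowed-interior) blocks-missed)
    where
    allowed-interior : ∀ x → allowed true (lb x) (lookup F x) ≡ true
    allowed-interior x with lb x in x-label | allᶠ-elim vertices-allowed x
    ... | unused | q = q
    ... | apex | _ = apex⊆F x x-label
    ... | block _ | _ = refl

  Pure : ℕ → Set
  Pure d = ∀ F → Face F → (∣ F ∣ ≤ d) × ∃[ G ] (Face G × ∣ G ∣ ≡ d × F ⊆ₗ G)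

  isFacetAbove : ℕ → Subset n → Subset n → Bool
  isFacetAbove d G H = isJoinFace lb noneMissed false H ∧ ((∣ H ∣ ≡ᵇ d) ∧ (G ⊆ᵇ H))

  OnBoundary : ℕ → Subset n → Set
  OnBoundary d F = ∃[ G ] (Face G × ∣ G ∣ ≡ d ℕ.∸ 1 × F ⊆ₗ G × countᵇ (isFacetAbove d G) (allSubsets n) ≡ 1)

  isFacetAbove-intro : ∀ {d} G {H} → Face H → ∣ H ∣ ≡ d → G ⊆ₗ H → isFacetAbove d G H ≡ true
  isFacetAbove-intro {d} G {H} face ∣H∣≡d G⊆H =
    ∧≡true⁺ (Face.isFace face) (∧≡true⁺ (subst (λ m → (∣ H ∣ ≡ᵇ m) ≡ true) ∣H∣≡d (≡ᵇ-refl ∣ H ∣)) (⊆ᵇ-complete G H G⊆H))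

  isFacetAbove-elim : ∀ {d} G H → isFacetAbove d G H ≡ true → Face H × ∣ H ∣ ≡ d × G ⊆ₗ H
  isFacetAbove-elim {d} G H e with ∧≡true⁻ (isJoinFace lb noneMissed false H) e
  ... | face , e′ with ∧≡true⁻ (∣ H ∣ ≡ᵇ d) e′
  ...   | ∣H∣≡ᵇd , G⊆ᵇH = mkFace face , ≡ᵇ≡true⇒≡ ∣H∣≡ᵇd , ⊆ᵇ-sound G H G⊆ᵇH

  -- A facet missing an apex vertex x could be extended by x.
  facet-apex : ∀ {d} → Pure d → ∀ {H} → Face H → ∣ H ∣ ≡ d → ∀ x → lb x ≡ apex → lookup H x ≡ true
  facet-apex {d} pure {H} face ∣H∣≡d x x-apex with lookup H x in x∈H
  ... | true = refl
  ... | false = contradiction (subst (λ m → suc m ≤ d) ∣H∣≡d (subst (_≤ d) (∣insert∣ H x x∈H)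
                    (proj₁ (pure _ (face-insertApex face x x-apex)))))
                  (ℕP.<-irrefl refl)

  missesApex⇒onBoundary : ∀ {d} → Pure d → ∀ {F} → Face F → ∀ x → lb x ≡ apex → lookup F x ≡ false → OnBoundary d F
  missesApex⇒onBoundary {d} pure {F} face x x-apex x∉F with pure F face
  ... | _ , H , H-face , ∣H∣≡d , F⊆H =
    H [ x ]≔ false , face-downward H-face (delete-⊆ₗ H x) , ∣H-x∣≡d-1 , ⊆ₗ-delete F H x F⊆H x∉F ,
    count-unique (isFacetAbove d (H [ x ]≔ false)) H (isFacetAbove-intro (H [ x ]≔ false) H-face ∣H∣≡d (delete-⊆ₗ H x)) unique
    where
    ∣H-x∣≡d-1 : ∣ H [ x ]≔ false ∣ ≡ d ℕ.∸ 1
    ∣H-x∣≡d-1 = cong (ℕ._∸ 1) (trans (∣delete∣ H x (facet-apex pure H-face ∣H∣≡d x x-apex)) ∣H∣≡d)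
    unique : ∀ H′ → isFacetAbove d (H [ x ]≔ false) H′ ≡ true → H′ ≡ H
    unique H′ e with isFacetAbove-elim (H [ x ]≔ false) H′ e
    ... | H′-face , ∣H′∣≡d , H-x⊆H′ = sym (⊆ₗ∧∣∣≡⇒≡ H H′ H⊆H′ (trans ∣H∣≡d (sym ∣H′∣≡d)))
      where
      H⊆H′ : H ⊆ₗ H′
      H⊆H′ y y∈H with x FinP.≟ y
      ... | yes refl = facet-apex pure H′-face ∣H′∣≡d y x-apex
      ... | no x≢y = H-x⊆H′ y (trans (VP.lookup∘update′ (≢-sym x≢y) H false) y∈H)

  -- Exchanging the vertex y of block β for another vertex z of β that H misses gives a second facet.
  twoFacetsAbove : ∀ {d G H y β} → Face G → suc ∣ G ∣ ≡ d → Face H → ∣ H ∣ ≡ d → G ⊆ₗ H →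
    lookup H y ≡ true → lookup G y ≡ false → lb y ≡ block β → 2 ≤ countᵇ (isFacetAbove d G) (allSubsets n)
  twoFacetsAbove {d} {G} {H} {y} {β} G-face ∣G∣+1≡d H-face ∣H∣≡d G⊆H y∈H y∉G y∈β with face-missesBlock H-face β
  ... | z , z∈β , z∉H =
    count-two (isFacetAbove d G) H (G [ z ]≔ true) (isFacetAbove-intro G H-face ∣H∣≡d G⊆H)
      (isFacetAbove-intro G H₂-face (trans (∣insert∣ G z z∉G) ∣G∣+1≡d) (⊆ₗ-insert G z))
      (λ H≡H₂ → BP.not-¬ (trans (cong (λ V → lookup V z) H≡H₂) (VP.lookup∘update z G true)) z∉H)
    where
    z∉G : lookup G z ≡ false
    z∉G = BP.¬-not (λ z∈G → BP.not-¬ (G⊆H z z∈G) z∉H)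
    H₂-face : Face (G [ z ]≔ true)
    H₂-face = face-insert G-face (λ z-unused → contradiction (trans (sym z-unused) z∈β) λ ()) misses
      where
      misses : ∀ γ → ∃[ w ] (lb w ≡ block γ × w ≢ z × lookup G w ≡ false)
      misses γ with γ FinP.≟ β
      ... | yes refl = y , y∈β , (λ y≡z → BP.not-¬ (subst (λ v → lookup H v ≡ true) y≡z y∈H) z∉H) , y∉G
      ... | no γ≢β = face-missesBlock-elsewhere G-face γ (λ z∈γ → γ≢β (block-injective (trans (sym z∈γ) z∈β)))
        where
        block-injective : ∀ {γ β : Fin k} → block γ ≡ block β → γ ≡ β
        block-injective refl = refl

  interior⊎missesApex : ∀ {F} → Face F → InteriorFace F ⊎ ∃[ x ] (lb x ≡ apex × lookup F x ≡ false)
  interior⊎missesApex {F} face with anyᶠ (λ x → isApex (lb x) ∧ not (lookup F x)) in some-missed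
  ... | true with anyᶠ-elim some-missed
  ...   | x , q with ∧≡true⁻ (isApex (lb x)) q
  ...     | x-apex , x∉F = inj₂ (x , isApex-true (lb x) x-apex , not≡true⇒≡false x∉F)
  interior⊎missesApex {F} face | false = inj₁ (interior-intro face apex⊆F)
    where
    apex⊆F : ∀ x → lb x ≡ apex → lookup F x ≡ true
    apex⊆F x x-apex = BP.¬-not λ x∉F →
      BP.not-¬ (anyᶠ-intro {p = λ x → isApex (lb x) ∧ not (lookup F x)} x (cong₂ _∧_ (cong isApex x-apex) (cong not x∉F)))
        some-missed

  onBoundary⇒missesApex : ∀ {d} → Pure d → ∀ x₀ → lb x₀ ≡ apex → ∀ F → OnBoundary d F →
    ∃[ x ] (lb x ≡ apex × lookup F x ≡ false)
  onBoundary⇒missesApex {d} pure x₀ x₀-apex F (G , G-face , ∣G∣≡d-1 , F⊆G , one-facet)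
    with interior⊎missesApex (face-downward {F} G-face F⊆G)
  ... | inj₂ misses-apex = misses-apex
  ... | inj₁ interior = contradiction (subst (2 ≤_) one-facet two-facets) λ { (s≤s ()) }
    where
    apex⊆G : ∀ x → lb x ≡ apex → lookup G x ≡ true
    apex⊆G x x-apex = F⊆G x (interior-apex interior x x-apex)
    1≤d : 1 ≤ d
    1≤d = ℕP.≤-trans (∣∣-pos G x₀ (apex⊆G x₀ x₀-apex)) (ℕP.≤-trans (ℕP.≤-reflexive ∣G∣≡d-1) (ℕP.m∸n≤m d 1))
    ∣G∣+1≡d : suc ∣ G ∣ ≡ d
    ∣G∣+1≡d = trans (cong suc ∣G∣≡d-1) (ℕP.m+[n∸m]≡n 1≤d)
    two-facets : 2 ≤ countᵇ (isFacetAbove d G) (allSubsets n)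
    two-facets with pure G G-face
    ... | _ , H , H-face , ∣H∣≡d , G⊆H with ⊆ₗ∧∣∣<⇒∃ G H G⊆H (ℕP.≤-reflexive (trans ∣G∣+1≡d (sym ∣H∣≡d)))
    ...   | y , y∈H , y∉G = by-label (lb y) refl
      where
      by-label : ∀ l → lb y ≡ l → 2 ≤ countᵇ (isFacetAbove d G) (allSubsets n)
      by-label unused y-unused = ⊥-elim (BP.not-¬ y∈H (face-unused H-face y y-unused))
      by-label apex y-apex = ⊥-elim (BP.not-¬ (apex⊆G y y-apex) y∉G)
      by-label (block β) y∈β = twoFacetsAbove G-face ∣G∣+1≡d H-face ∣H∣≡d G⊆H y∈H y∉G y∈β

module _ {n : ℕ} (J : PSJoin n) where

  face⇔ : ∀ {F} → (joinComplex J ∋ F) ⇔ Face (lab J) F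
  face⇔ {F} = mk⇔ (λ e → mkFace (trans (sym (joinComplex≡isJoinFace J F)) e))
                  (λ (mkFace e) → trans (joinComplex≡isJoinFace J F) e)

  pure⇒Pure : ∀ d → IsPureDim d (joinComplex J) → Pure (lab J) d
  pure⇒Pure d pure F face with pure F (Equivalence.from face⇔ face)
  ... | ∣F∣≤d , G , G-face , ∣G∣≡d , F⊆G = ∣F∣≤d , G , Equivalence.to face⇔ G-face , ∣G∣≡d , ⊆⇒⊆ₗ F⊆G

  facetsContaining≡ : ∀ d G → facetsContaining d (joinComplex J) G ≡ countᵇ (isFacetAbove (lab J) d G) (allSubsets n)
  facetsContaining≡ d G = count-cong (λ H → cong (_∧ ((∣ H ∣ ≡ᵇ d) ∧ (G ⊆ᵇ H))) (joinComplex≡isJoinFace J H)) (allSubsets n)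

  boundary⇔ : ∀ d F → Boundary d (joinComplex J) F ⇔ OnBoundary (lab J) d F
  boundary⇔ d F = mk⇔
    (λ (G , G-face , ∣G∣≡d-1 , F⊆G , one) →
       G , Equivalence.to face⇔ G-face , ∣G∣≡d-1 , ⊆⇒⊆ₗ F⊆G , trans (sym (facetsContaining≡ d G)) one)
    (λ (G , G-face , ∣G∣≡d-1 , F⊆G , one) →
       G , Equivalence.from face⇔ G-face , ∣G∣≡d-1 , ⊆ₗ⇒⊆ F⊆G , trans (facetsContaining≡ d G) one)

  pure⇒dim≡facetSize : ∀ d → IsPureDim d (joinComplex J) → BlocksNonempty J → d ≡ facetSize (lab J) noneMissed
  pure⇒dim≡facetSize d pure nonempty
    with join-hasFaceOfFacetSize (lab J) noneMissed (λ β _ → blockSize-pos (lab J) β (proj₁ (nonempty β)) (proj₂ (nonempty β)))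
  ... | F , F-face , ∣F∣≡size with pure⇒Pure d pure F (mkFace F-face)
  ...   | ∣F∣≤d , G , mkFace G-face , ∣G∣≡d , _ =
    ℕP.≤-antisym (subst (_≤ facetSize (lab J) noneMissed) ∣G∣≡d (joinFace-size≤facetSize (lab J) noneMissed false G G-face))
                 (subst (_≤ d) ∣F∣≡size ∣F∣≤d)

-- Ear decompositions

firstWith : ∀ {k} → (Fin k → Bool) → Fin k → Bool
firstWith b zero = b zero
firstWith b (suc e) = not (b zero) ∧ firstWith (b ∘ suc) e

firstWith-partition : ∀ {k} (b : Fin k → Bool) (w : ℤ) →
  (if anyᶠ b then w else 0ℤ) ≡ ∑[ e < k ] (if firstWith b e then w else 0ℤ)
firstWith-partition {zero} b w = refl
firstWith-partition {suc k} b w with b zero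
... | true = sym (trans (cong (_+_ w) (sum-replicate-zero k)) (ℤP.+-identityʳ w))
... | false = trans (firstWith-partition (b ∘ suc) w) (sym (ℤP.+-identityˡ _))

firstWith⇒ : ∀ {k} (b : Fin k → Bool) e → firstWith b e ≡ true → b e ≡ true × (∀ e′ → toℕ e′ < toℕ e → b e′ ≡ false)
firstWith⇒ b zero first = first , λ _ ()
firstWith⇒ b (suc e) first with b zero in b₀
... | false with firstWith⇒ (b ∘ suc) e first
...   | b-e , earlier = b-e , none-before
  where
  none-before : ∀ e′ → toℕ e′ < toℕ (suc e) → b e′ ≡ false
  none-before zero _ = b₀
  none-before (suc e′) (s≤s e′<e) = earlier e′ e′<e

firstWith⇐ : ∀ {k} (b : Fin k → Bool) e → b e ≡ true → (∀ e′ → toℕ e′ < toℕ e → b e′ ≡ false) → firstWith b e ≡ true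
firstWith⇐ b zero b-e _ = b-e
firstWith⇐ b (suc e) b-e none-before rewrite none-before zero (s≤s z≤n) =
  firstWith⇐ (b ∘ suc) e b-e (λ e′ e′<e → none-before (suc e′) (s≤s e′<e))

chainDegree-tabulate : ∀ {k} (c : Fin k → ℕ) → chainDegree (Vec.tabulate c) ≡ sumℕ {k} (λ β → c β ℕ.∸ 1)
chainDegree-tabulate {zero} c = refl
chainDegree-tabulate {suc k} c = cong ((c zero ℕ.∸ 1) ℕ.+_) (chainDegree-tabulate (c ∘ suc))

module _ {d n} {Δ : Complex n} (E : PSEarDecomposition d Δ) where
  open PSEarDecomposition E

  ear : Fin (suc m) → Subset n → Bool
  ear e = joinComplex (ears e)

  newFaces : Fin (suc m) → Subset n → Bool
  newFaces e F = firstWith (λ e′ → ear e′ F) e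

  chains : (e : Fin (suc m)) → Fin (k (ears e)) → ℕ
  chains e = chainLengths (lab (ears e)) noneMissed

  apexSizeOf : Fin (suc m) → ℕ
  apexSizeOf e = apexSize (lab (ears e))

  Δ≡anyEar : ∀ F → Δ F ≡ anyᶠ (λ e → ear e F)
  Δ≡anyEar F with Δ F in F∈Δ | anyᶠ (λ e → ear e F) in F∈ears
  ... | true | true = refl
  ... | false | false = refl
  ... | true | false with Equivalence.to (cover F) F∈Δ
  ...   | e , F∈e = ⊥-elim (BP.not-¬ (anyᶠ-intro {p = λ e → ear e F} e F∈e) F∈ears)
  Δ≡anyEar F | false | true with anyᶠ-elim {p = λ e → ear e F} F∈ears
  ...   | e , F∈e = ⊥-elim (BP.not-¬ (Equivalence.from (cover F) (e , F∈e)) F∈Δ)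

  hSum-byEar : ∀ D i → hSum D i Δ ≡ ∑[ e < suc m ] hSum D i (newFaces e)
  hSum-byEar D i =
    trans (sumBy-cong (λ F → trans (cong (λ b → if b then hWeight D i ∣ F ∣ else 0ℤ) (Δ≡anyEar F))
                                   (firstWith-partition (λ e → ear e F) (hWeight D i ∣ F ∣))) (allSubsets n))
      (sumBy-sum (suc m) (λ e F → if newFaces e F then hWeight D i ∣ F ∣ else 0ℤ) (allSubsets n))

  d≡facetSize : ∀ e → d ≡ facetSize (lab (ears e)) noneMissed
  d≡facetSize e = pure⇒dim≡facetSize (ears e) d (pure e) (blocksNonempty e)

  d≡apexSize+chainDegree : ∀ e → d ≡ apexSizeOf e ℕ.+ chainDegree (Vec.tabulate (chains e))
  d≡apexSize+chainDegree e =
    trans (d≡facetSize e) (trans (facetSize-closed (lab (ears e)) noneMissed)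
      (cong (apexSizeOf e ℕ.+_) (sym (chainDegree-tabulate (chains e)))))

  chains-positive : ∀ e β → 1 ≤ chains e β
  chains-positive e β = blockSize-pos (lab (ears e)) β (proj₁ (blocksNonempty e β)) (proj₂ (blocksNonempty e β))

  apexSizeOf-first : apexSizeOf zero ≡ 0
  apexSizeOf-first = apexSize-0 (lab (ears zero)) firstSphere

  apexSizeOf-later : ∀ j → 1 ≤ apexSizeOf (suc j)
  apexSizeOf-later j = apexSize-pos (lab (ears (suc j))) (proj₁ (laterBalls j)) (proj₂ (laterBalls j))

  -- By glue, the new faces of Δⱼ₊₁ are those off its boundary, i.e. those containing its apex.
  newFaces-ball : ∀ j F → newFaces (suc j) F ≡ isJoinFace (lab (ears (suc j))) noneMissed true F
  newFaces-ball j F with isJoinFace (lab (ears (suc j))) noneMissed true F in interior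
  ... | true = firstWith⇐ (λ e → ear e F) (suc j) F∈ear none-before
    where
    lb = lab (ears (suc j))
    F∈ear : ear (suc j) F ≡ true
    F∈ear = Equivalence.from (face⇔ (ears (suc j)) {F}) (interior⇒face lb {F} (mkInteriorFace interior))
    none-before : ∀ e → toℕ e < toℕ (suc j) → ear e F ≡ false
    none-before e e<j = BP.¬-not λ F∈e →
      let (x , x-apex , x∉F) = onBoundary⇒missesApex lb (pure⇒Pure (ears (suc j)) d (pure (suc j)))
                                 (proj₁ (laterBalls j)) (proj₂ (laterBalls j)) F
                                 (Equivalence.to (boundary⇔ (ears (suc j)) d F)
                                   (Equivalence.to (glue j F) (F∈ear , e , e<j , F∈e)))
      in BP.not-¬ (interior-apex lb {F} (mkInteriorFace interior) x x-apex) x∉F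
  ... | false = BP.¬-not λ first → not-new (firstWith⇒ (λ e → ear e F) (suc j) first)
    where
    lb = lab (ears (suc j))
    not-new : ear (suc j) F ≡ true × (∀ e → toℕ e < toℕ (suc j) → ear e F ≡ false) → ⊥
    not-new (F∈ear , none-before) with interior⊎missesApex lb (Equivalence.to (face⇔ (ears (suc j)) {F}) F∈ear)
    ... | inj₁ (mkInteriorFace F-interior) = BP.not-¬ F-interior interior
    ... | inj₂ (x , x-apex , x∉F) with Equivalence.from (glue j F) (Equivalence.from (boundary⇔ (ears (suc j)) d F)
                                          (missesApex⇒onBoundary lb (pure⇒Pure (ears (suc j)) d (pure (suc j)))
                                            (Equivalence.to (face⇔ (ears (suc j)) {F}) F∈ear) x x-apex x∉F))
    ...   | _ , e , e<j , F∈e = BP.not-¬ F∈e (none-before e e<j)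

  sphereTerm : ℕ → ℤ
  sphereTerm i = chainProductᶠ (chains zero) (+ i - + 0)

  ballTerm : Fin m → ℕ → ℤ
  ballTerm j i = chainProductᶠ (chains (suc j)) (+ i - + apexSizeOf (suc j))

  hvec≡earTerms : ∀ i → i ≤ d → hvec d Δ i ≡ sphereTerm i + ∑[ j < m ] ballTerm j i
  hvec≡earTerms i i≤d =
    trans (hvec≡hSum d Δ i i≤d) (trans (hSum-byEar d i) (cong₂ _+_ sphere (sum-cong-≗ {m} ball)))
    where
    sphere : hSum d i (newFaces zero) ≡ sphereTerm i
    sphere = trans (hSum-cong d i (joinComplex≡isJoinFace (ears zero)))
      (trans (cong (λ D → hSum D i (isJoinFace (lab (ears zero)) noneMissed false)) (d≡facetSize zero))
        (hSum-join (lab (ears zero)) noneMissed false i))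
    ball : ∀ j → hSum d i (newFaces (suc j)) ≡ ballTerm j i
    ball j = trans (hSum-cong d i (newFaces-ball j))
      (trans (cong (λ D → hSum D i (isJoinFace (lab (ears (suc j))) noneMissed true)) (d≡facetSize (suc j)))
        (hSum-join (lab (ears (suc j))) noneMissed true i))

  chainDegreeOf : Fin (suc m) → ℕ
  chainDegreeOf e = chainDegree (Vec.tabulate (chains e))

  d≡chainDegree-first : d ≡ chainDegreeOf zero
  d≡chainDegree-first = trans (d≡apexSize+chainDegree zero) (cong (ℕ._+ chainDegreeOf zero) apexSizeOf-first)

  sphereTerm-reflect : ∀ i → i ≤ d → sphereTerm (d ℕ.∸ i) ≡ sphereTerm i
  sphereTerm-reflect i i≤d =
    trans (cong (chainProductᶠ (chains zero)) reflect)
      (sym (chainProduct-palindromic (Vec.tabulate (chains zero)) (+ i - + 0)))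
    where
    E-x-0≡E-[x-0] : ∀ E x → E - x - 0ℤ ≡ E - (x - 0ℤ)
    E-x-0≡E-[x-0] = solve-∀
    reflect : + (d ℕ.∸ i) - + 0 ≡ + chainDegreeOf zero - (+ i - + 0)
    reflect = trans (cong (_- + 0) (trans (+[m∸n]≡+m-+n i≤d) (cong (λ e → + e - + i) d≡chainDegree-first)))
                (E-x-0≡E-[x-0] (+ chainDegreeOf zero) (+ i))

  ballTerm-reflect : ∀ j i → i ≤ d → ballTerm j (d ℕ.∸ i) ≡ chainProductᶠ (chains (suc j)) (+ i)
  ballTerm-reflect j i i≤d =
    trans (cong (chainProductᶠ (chains (suc j))) reflect)
      (sym (chainProduct-palindromic (Vec.tabulate (chains (suc j))) (+ i)))
    where
    s+E-x-s≡E-x : ∀ s E x → s + E - x - s ≡ E - x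
    s+E-x-s≡E-x = solve-∀
    reflect : + (d ℕ.∸ i) - + apexSizeOf (suc j) ≡ + chainDegreeOf (suc j) - + i
    reflect = trans (cong (_- + apexSizeOf (suc j)) (trans (+[m∸n]≡+m-+n i≤d) (cong (λ e → + e - + i) (d≡apexSize+chainDegree (suc j)))))
                (s+E-x-s≡E-x (+ apexSizeOf (suc j)) (+ chainDegreeOf (suc j)) (+ i))

  sphereTerm-top : sphereTerm d ≡ 1ℤ
  sphereTerm-top =
    trans (cong (chainProductᶠ (chains zero)) (trans (ℤP.+-identityʳ (+ d)) (cong +_ d≡chainDegree-first)))
      (chainProduct-at-degree (AllVecP.tabulate⁺ (chains-positive zero)))

  ballTerm-top : ∀ j → ballTerm j d ≡ 1ℤ
  ballTerm-top j =
    trans (cong (chainProductᶠ (chains (suc j)))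
            (trans (cong (λ e → + e - + apexSizeOf (suc j)) (d≡apexSize+chainDegree (suc j)))
              (s+E-s≡E (+ apexSizeOf (suc j)) (+ chainDegreeOf (suc j)))))
      (chainProduct-at-degree (AllVecP.tabulate⁺ (chains-positive (suc j))))
    where
    s+E-s≡E : ∀ s E → s + E - s ≡ E
    s+E-s≡E = solve-∀

  hvec-top : hvec d Δ d ≡ 1ℤ + + m
  hvec-top = trans (hvec≡earTerms d ℕP.≤-refl) (cong₂ _+_ sphereTerm-top (trans (sum-cong-≗ {m} ballTerm-top) (sum-ones m)))

  ballMVector : Fin m → ℕ → ℕ
  ballMVector j = hilbert (apexSizeOf (suc j) ∷ Vec.tabulate (chains (suc j)))

  ballMVector-isMVector : ∀ j → IsMVector ⌊ d /2⌋ (ballMVector j)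
  ballMVector-isMVector j =
    hilbert-isMVector ⌊ d /2⌋ _ (apexSizeOf-later j ∷ AllVecP.tabulate⁺ (chains-positive (suc j)))

  ballMVector≡ : ∀ j i → 2 ℕ.* i ≤ d → + ballMVector j i ≡ chainProductᶠ (chains (suc j)) (+ i) - ballTerm j i
  ballMVector≡ j i 2i≤d =
    trans (hilbert≡Δ-chainProduct (s ∷ Vec.tabulate (chains (suc j))) i (subst (2 ℕ.* i ≤_) (sym 1+degree≡d) 2i≤d))
      (mulChain-difference s (chainProductᶠ (chains (suc j))) (+ i))
    where
    s = apexSizeOf (suc j)
    1+degree≡d : suc (s ℕ.∸ 1 ℕ.+ chainDegreeOf (suc j)) ≡ d
    1+degree≡d = trans (cong (ℕ._+ chainDegreeOf (suc j)) (ℕP.m+[n∸m]≡n (apexSizeOf-later j)))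
                   (sym (d≡apexSize+chainDegree (suc j)))

  hbar≡sum-ballMVector : ∀ i → i ≤ ⌊ d /2⌋ → hbar d Δ i ≡ ∑[ j < m ] (+ ballMVector j i)
  hbar≡sum-ballMVector i i≤d/2 =
    begin
      hvec d Δ (d ℕ.∸ i) - hvec d Δ i
    ≡⟨ cong₂ _-_ (hvec≡earTerms (d ℕ.∸ i) (ℕP.m∸n≤m d i)) (hvec≡earTerms i i≤d) ⟩
      (sphereTerm (d ℕ.∸ i) + ∑[ j < m ] ballTerm j (d ℕ.∸ i)) - (sphereTerm i + ∑[ j < m ] ballTerm j i)
    ≡⟨ cong (λ x → (x + ∑[ j < m ] ballTerm j (d ℕ.∸ i)) - (sphereTerm i + ∑[ j < m ] ballTerm j i)) (sphereTerm-reflect i i≤d) ⟩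
      (sphereTerm i + ∑[ j < m ] ballTerm j (d ℕ.∸ i)) - (sphereTerm i + ∑[ j < m ] ballTerm j i)
    ≡⟨ cancel (sphereTerm i) _ _ ⟩
      ∑[ j < m ] ballTerm j (d ℕ.∸ i) - ∑[ j < m ] ballTerm j i
    ≡⟨ sym (sum-difference m (λ j → ballTerm j (d ℕ.∸ i)) (λ j → ballTerm j i)) ⟩
      ∑[ j < m ] (ballTerm j (d ℕ.∸ i) - ballTerm j i)
    ≡⟨ sum-cong-≗ {m} (λ j → trans (cong (_- ballTerm j i) (ballTerm-reflect j i i≤d)) (sym (ballMVector≡ j i 2i≤d))) ⟩
      ∑[ j < m ] (+ ballMVector j i)
    ∎
    where
    open ≡-Reasoning
    2i≤d : 2 ℕ.* i ≤ d
    2i≤d = ℕP.≤-trans (ℕP.*-monoʳ-≤ 2 i≤d/2) 2⌊d/2⌋≤d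
      where
      2⌊d/2⌋≤d : 2 ℕ.* ⌊ d /2⌋ ≤ d
      2⌊d/2⌋≤d = subst (2 ℕ.* ⌊ d /2⌋ ≤_) (ℕP.⌊n/2⌋+⌈n/2⌉≡n d)
                   (ℕP.+-monoʳ-≤ ⌊ d /2⌋ (ℕP.≤-trans (ℕP.≤-reflexive (ℕP.+-identityʳ ⌊ d /2⌋)) (ℕP.⌊n/2⌋≤⌈n/2⌉ d)))
    i≤d : i ≤ d
    i≤d = ℕP.≤-trans (ℕP.m≤m+n i (i ℕ.+ 0)) 2i≤d
    cancel : ∀ a x y → (a + x) - (a + y) ≡ x - y
    cancel = solve-∀

sumℤ-map-tabulate : ∀ m (f : Fin m → ℕ → ℕ) i → sumℤ (map (λ M → + M i) (List.tabulate f)) ≡ ∑[ j < m ] (+ f j i)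
sumℤ-map-tabulate zero f i = refl
sumℤ-map-tabulate (suc m) f i = cong (_+_ (+ f zero i)) (sumℤ-map-tabulate m (f ∘ suc) i)

-- The ear decomposition determines Δ through its cover field.
mainTheorem6 : ∀ (d n : ℕ) (Δ : Complex n) →
    IsSimplicialComplex Δ → HasDim d Δ → PSEarDecomposition d Δ →
    ∃[ Ms ] ( All (IsMVector ⌊ d /2⌋) Ms
    × (+ length Ms ≡ hvec d Δ d - 1ℤ)
    × (∀ i → i ≤ ⌊ d /2⌋ → hbar d Δ i ≡ sumℤ (map (λ M → + M i) Ms)))
mainTheorem6 d n Δ _ _ E =
  List.tabulate (ballMVector E) ,
  AllP.tabulate⁺ (ballMVector-isMVector E) ,
  trans (cong +_ (LP.length-tabulate (ballMVector E)))
    (trans (sym (1+m-1≡m (+ m))) (cong (_- 1ℤ) (sym (hvec-top E)))) ,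
  λ i i≤d/2 → trans (hbar≡sum-ballMVector E i i≤d/2) (sym (sumℤ-map-tabulate m (ballMVector E) i))
  where
  open PSEarDecomposition E using (m)
  1+m-1≡m : ∀ m → 1ℤ + m - 1ℤ ≡ m
  1+m-1≡m = solve-∀
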